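{- Two locally convex integer broken lines (or two convex integer polygons) are integer congruent if and only if their angle-curvature sequences coincide and their sequences of integer lengths of edges coincide.
   Context: Work in the integer lattice $\mathbb{Z}^2\subset\mathbb{R}^2$ with symmetry group $\mathrm{Aff}(2,\mathbb{Z})$ (integer affine, lattice-preserving transformations); two sets are integer congruent if some such transformation maps one bijectively onto the other. The integer length $\mathrm{l}\ell(AB)$ of an integer segment $AB$ is the number of connected components of $AB\setminus\mathbb{Z}^2$. An integer angle is rational if both of its edges contain integer points other than the vertex. An angle $\angle ABC$ is positively/negatively oriented if $BA,BC$ form a positive/negative basis. An integer broken line is locally convex if all its angles are simultaneously positively oriented or simultaneously negatively oriented; convex polygons (with vertices $A_1,\dots,A_n$ ordered anticlockwise, indices mod $n$) are locally convex. For a locally convex broken line $ABCD$ with no three consecutive points collinear, its chord curvature is $\varkappa(ABCD)=\mathrm{l}\ell(BC)-\mathrm{sgn}\langle BC,B'C'\rangle\cdot\mathrm{l}\ell(B'C')-2$, where $B'$ is the integer point of the angle $ABC$ at unit integer distance from the segment $BC$ closest to the line $AB$, $C'$ is the integer point of the angle $BCD$ at unit integer distance from $BC$ closest to the line $CD$, and $\mathrm{sgn}\langle BC,B'C'\rangle$ is $1$ if $B'C'$ has the same direction as $BC$, $0$ if $B'=C'$, and $-1$ if opposite. For a locally convex broken line $A_0A_1\dots A_nA_{n+1}$, set $\alpha_i$ to be (the integer congruence class of) the angle $\angle A_{i-1}A_iA_{i+1}$ for $i=1,\dots,n$ (in the paper written as the integer arctangent of the angle, a complete invariant of integer angles) and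 $\varkappa_i=\varkappa(A_{i-1}A_iA_{i+1}A_{i+2})$ for $i=1,\dots,n-1$; the angle-curvature sequence is $(\alpha_1,\varkappa_1,\dots,\alpha_{n-1},\varkappa_{n-1},\alpha_n)$. For a convex polygon $A_1\dots A_n$, the angle-curvature sequence is $(\alpha_1,\varkappa_1,\dots,\alpha_n,\varkappa_n)$ with $\alpha_i$ the class of $\angle A_{i-1}A_iA_{i+1}$ and $\varkappa_i=\varkappa(A_{i-1}A_iA_{i+1}A_{i+2})$ for $i=1,\dots,n$ (cyclic if no starting vertex is fixed). -}

module Defs where

open import Data.Nat as ℕ using (ℕ; zero; suc)
open import Data.Nat.GCD using (gcd)
open import Data.Integer using (ℤ; +_; -[1+_]; +[1+_]; _+_; _-_; _*_; -_; ∣_∣; _<_; 0ℤ; 1ℤ)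
open import Data.Product using (Σ; ∃; _×_; _,_)
open import Data.Sum using (_⊎_)
open import Relation.Binary.PropositionalEquality using (_≡_)

Point : Set
Point = ℤ × ℤ

_⊖_ : Point → Point → Point
(x , y) ⊖ (x′ , y′) = (x - x′ , y - y′)

_⊕_ : Point → Point → Point
(x , y) ⊕ (x′ , y′) = (x + x′ , y + y′)

_•_ : ℤ → Point → Point
k • (x , y) = (k * x , k * y)

det : Point → Point → ℤ
det (a , b) (c , d) = a * d - b * c

dot : Point → Point → ℤ
dot (a , b) (c , d) = a * c + b * d

sgnℤ : ℤ → ℤ
sgnℤ (+ zero)    = 0ℤ
sgnℤ +[1+ _ ]    = 1ℤ
sgnℤ -[1+ _ ]    = - 1ℤ

record Aff : Set where
  field
    a b c d e f : ℤ
    unimodular : (a * d - b * c ≡ 1ℤ) ⊎ (a * d - b * c ≡ - 1ℤ)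

apply : Aff → Point → Point
apply g (x , y) = (a * x + b * y + e , c * x + d * y + f)
  where open Aff g

-- Integer length of an integer segment PQ: number of components of
-- PQ ∖ ℤ², i.e. gcd of the absolute values of the coordinates of PQ.

lℓ : Point → Point → ℕ
lℓ P Q with Q ⊖ P
... | (x , y) = gcd ∣ x ∣ ∣ y ∣

-- v lies on the open ray spanned by u (positive rational multiple)
SameRay : Point → Point → Set
SameRay u v = Σ ℕ λ p → Σ ℕ λ q → (+ suc p) • u ≡ (+ suc q) • v

AngleCong : Point → Point → Point → Point → Point → Point → Set
AngleCong A B C A′ B′ C′ =
  Σ Aff λ g → (apply g B ≡ B′)
            × SameRay (apply g A ⊖ apply g B) (A′ ⊖ B′)
            × SameRay (apply g C ⊖ apply g B) (C′ ⊖ B′)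

PosAngle : Point → Point → Point → Set
PosAngle A B C = 0ℤ < det (A ⊖ B) (C ⊖ B)

NegAngle : Point → Point → Point → Set
NegAngle A B C = det (A ⊖ B) (C ⊖ B) < 0ℤ

InAngle : Point → Point → Point → Point → Set
InAngle A B C P =
  Σ ℕ λ p → Σ ℕ λ q → Σ ℕ λ r →
    (+ suc r) • (P ⊖ B) ≡ ((+ p) • (A ⊖ B)) ⊕ ((+ q) • (C ⊖ B))

-- ∣det(XY, XP)∣ = lℓ(XY) · (integer distance from P to the line XY)
ldetDist : Point → Point → Point → ℕ
ldetDist X Y P = ∣ det (Y ⊖ X) (P ⊖ X) ∣

UnitDist : Point → Point → Point → Set
UnitDist B C P = ldetDist B C P ≡ lℓ B C

IsB′ : Point → Point → Point → Point → Set
IsB′ A B C P =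
  InAngle A B C P × UnitDist B C P
  × (∀ Q → InAngle A B C Q → UnitDist B C Q → ldetDist B A P ℕ.≤ ldetDist B A Q)

IsC′ : Point → Point → Point → Point → Set
IsC′ B C D P =
  InAngle B C D P × UnitDist B C P
  × (∀ Q → InAngle B C D Q → UnitDist B C Q → ldetDist C D P ℕ.≤ ldetDist C D Q)

ChordCurv : Point → Point → Point → Point → ℤ → Set
ChordCurv A B C D κ =
  Σ Point λ B′ → Σ Point λ C′ →
    IsB′ A B C B′ × IsC′ B C D C′
    × (κ ≡ (+ lℓ B C) - sgnℤ (dot (C ⊖ B) (C′ ⊖ B′)) * (+ lℓ B′ C′) - + 2)

-- Broken lines A₀ A₁ … Aₙ Aₙ₊₁ (given by A : ℕ → Point, indices 0..n+1)

LocallyConvex : ℕ → (ℕ → Point) → Set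
LocallyConvex n A =
  (∀ i → i ℕ.< n → PosAngle (A i) (A (suc i)) (A (suc (suc i))))
  ⊎ (∀ i → i ℕ.< n → NegAngle (A i) (A (suc i)) (A (suc (suc i))))

BrokenCong : ℕ → (ℕ → Point) → (ℕ → Point) → Set
BrokenCong n A B = Σ Aff λ g → ∀ i → i ℕ.≤ suc n → apply g (A i) ≡ B i

BrokenSameAC : ℕ → (ℕ → Point) → (ℕ → Point) → Set
BrokenSameAC n A B =
  (∀ i → i ℕ.< n →
     AngleCong (A i) (A (suc i)) (A (suc (suc i)))
               (B i) (B (suc i)) (B (suc (suc i))))
  × (∀ i → suc (suc i) ℕ.≤ n → Σ ℤ λ κ →
       ChordCurv (A i) (A (suc i)) (A (suc (suc i))) (A (suc (suc (suc i)))) κ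
       × ChordCurv (B i) (B (suc i)) (B (suc (suc i))) (B (suc (suc (suc i)))) κ)

BrokenSameLengths : ℕ → (ℕ → Point) → (ℕ → Point) → Set
BrokenSameLengths n A B =
  ∀ i → i ℕ.≤ n → lℓ (A i) (A (suc i)) ≡ lℓ (B i) (B (suc i))

-- Convex polygons A₁ … Aₙ, vertices anticlockwise; given as an
-- n-periodic map A : ℕ → Point (so A 0 = Aₙ, indices mod n)

ConvexPolygon : ℕ → (ℕ → Point) → Set
ConvexPolygon n A =
  (3 ℕ.≤ n)
  × (∀ i → A (i ℕ.+ n) ≡ A i)
  × (∀ i k → 2 ℕ.≤ k → k ℕ.< n →
       0ℤ < det (A (suc i) ⊖ A i) (A (i ℕ.+ k) ⊖ A i))

PolyCong : ℕ → (ℕ → Point) → (ℕ → Point) → Set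
PolyCong n A B = Σ Aff λ g → ∀ i → apply g (A i) ≡ B i

PolySameAC : ℕ → (ℕ → Point) → (ℕ → Point) → Set
PolySameAC n A B =
  (∀ i → AngleCong (A i) (A (suc i)) (A (suc (suc i)))
                   (B i) (B (suc i)) (B (suc (suc i))))
  × (∀ i → Σ ℤ λ κ →
       ChordCurv (A i) (A (suc i)) (A (suc (suc i))) (A (suc (suc (suc i)))) κ
       × ChordCurv (B i) (B (suc i)) (B (suc (suc i))) (B (suc (suc (suc i)))) κ)

PolySameLengths : ℕ → (ℕ → Point) → (ℕ → Point) → Set
PolySameLengths n A B = ∀ i → lℓ (A i) (A (suc i)) ≡ lℓ (B i) (B (suc i))

-- An integer affine map preserves integer lengths and rays, and changes determinants only by a
-- sign, so it carries every datum of the angle-curvature sequence (the points B′, C′ included)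
-- to the corresponding datum of the image. Conversely, an angle congruence that also matches the
-- lengths of both edges matches three consecutive vertices. Given a congruence g of A₀ … Aₖ₊₂ onto
-- B₀ … Bₖ₊₂, the congruence h of the next angles sends C′ to C′, g sends B′ to B′, and equal chord
-- curvatures force g C′ = C′ as well, since g C′ and C′ lie on the parallel to the middle edge through
-- B′ at the same signed length. So g and h agree on three non-collinear points, hence everywhere,
-- and g also matches Aₖ₊₃; induction along the line, or around the polygon, gives the congruence.

module Submission where

open import Defs
open import Data.Nat as ℕ using (ℕ; zero; suc; z≤n; s≤s)
import Data.Nat.Properties as ℕP
open import Data.Nat.GCD
  using (gcd; gcd[m,n]∣m; gcd[m,n]∣n; gcd-greatest; c*gcd[m,n]≡gcd[cm,cn]; gcd[m,n]≡0⇒m≡0;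
         gcd[m,n]≡0⇒n≡0; gcd[0,0]≡0; gcd-identityʳ; gcd-GCD; module Bézout)
open import Data.Nat.Divisibility using (∣-antisym) renaming (_∣_ to _∣ℕ_)
open import Data.Integer hiding (_⊖_; suc)
import Data.Sign.Base as Sign
open import Data.Integer.Properties
open import Data.Integer.Divisibility.Signed
  using (divides; ∣ᵤ⇒∣; ∣⇒∣ᵤ; ∣m∣n⇒∣m+n; ∣n⇒∣m*n) renaming (_∣_ to _∣ℤ_)
open import Data.Integer.DivMod using (_/ℕ_; _%ℕ_; a≡a%ℕn+[a/ℕn]*n; n%ℕd<d)
open import Data.Integer.Tactic.RingSolver using (solve-∀)
open import Data.Product using (Σ; _×_; _,_; proj₁; proj₂)
open import Data.Sum using (_⊎_; inj₁; inj₂)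
open import Data.Empty using (⊥-elim)
open import Relation.Binary.PropositionalEquality
open import Function.Base using (_∘_)
open import Function.Bundles using (_⇔_; mk⇔)

open Aff

-- Vectors

origin : Point
origin = (0ℤ , 0ℤ)

⊖-identityʳ : ∀ v → v ⊖ origin ≡ v
⊖-identityʳ (x , y) = cong₂ _,_ (+-identityʳ x) (+-identityʳ y)

⊖-self : ∀ P → P ⊖ P ≡ origin
⊖-self (x , y) = cong₂ _,_ (+-inverseʳ x) (+-inverseʳ y)

⊖-cancelʳ : ∀ P Q B → P ⊖ B ≡ Q ⊖ B → P ≡ Q
⊖-cancelʳ (x , y) (x′ , y′) (b , b′) eq =
  cong₂ _,_ (cancel x x′ b (cong proj₁ eq)) (cancel y y′ b′ (cong proj₂ eq))
  where
  sub-add : ∀ i k → i - k + k ≡ i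
  sub-add = solve-∀
  cancel : ∀ i j k → i - k ≡ j - k → i ≡ j
  cancel i j k eq = trans (sym (sub-add i k)) (trans (cong (_+ k) eq) (sub-add j k))

•-cancelˡ : ∀ k u v → k ≢ 0ℤ → k • u ≡ k • v → u ≡ v
•-cancelˡ k (x , y) (x′ , y′) k≢0 eq = cong₂ _,_
  (*-cancelˡ-≡ k x x′ (cong proj₁ eq)) (*-cancelˡ-≡ k y y′ (cong proj₂ eq))
  where instance _ = ≢-nonZero k≢0

det-antisym : ∀ u v → det u v ≡ - det v u
det-antisym (x , y) (x′ , y′) = identity x y x′ y′
  where
  identity : ∀ x y x′ y′ → x * y′ - y * x′ ≡ - (x′ * y - y′ * x)
  identity = solve-∀

det-self : ∀ u → det u u ≡ 0ℤ
det-self (x , y) = identity x y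
  where
  identity : ∀ x y → x * y - y * x ≡ 0ℤ
  identity = solve-∀

det-originʳ : ∀ u → det u origin ≡ 0ℤ
det-originʳ (x , y) = identity x y
  where
  identity : ∀ x y → x * 0ℤ - y * 0ℤ ≡ 0ℤ
  identity = solve-∀

det-combʳ : ∀ u p v q w → det u ((p • v) ⊕ (q • w)) ≡ p * det u v + q * det u w
det-combʳ (x , y) p (v , v′) q (w , w′) = identity x y p v v′ q w w′
  where
  identity : ∀ x y p v v′ q w w′ →
    x * (p * v′ + q * w′) - y * (p * v + q * w) ≡ p * (x * v′ - y * v) + q * (x * w′ - y * w)
  identity = solve-∀

det-•ʳ : ∀ u k v → det u (k • v) ≡ k * det u v
det-•ʳ (x , y) k (v , v′) = identity x y k v v′
  where
  identity : ∀ x y k v v′ → x * (k * v′) - y * (k * v) ≡ k * (x * v′ - y * v)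
  identity = solve-∀

dot-•ʳ : ∀ u k v → dot u (k • v) ≡ k * dot u v
dot-•ʳ (x , y) k (v , v′) = identity x y k v v′
  where
  identity : ∀ x y k v v′ → x * (k * v) + y * (k * v′) ≡ k * (x * v + y * v′)
  identity = solve-∀

-- Cramer's rule, multiplied out so that no division occurs.
cramer : ∀ u v w → det u v • w ≡ ((- det v w) • u) ⊕ (det u w • v)
cramer (u , u′) (v , v′) (w , w′) = cong₂ _,_ (first u u′ v v′ w w′) (second u u′ v v′ w w′)
  where
  first : ∀ u u′ v v′ w w′ → (u * v′ - u′ * v) * w ≡ (- (v * w′ - v′ * w)) * u + (u * w′ - u′ * w) * v
  first = solve-∀
  second : ∀ u u′ v v′ w w′ → (u * v′ - u′ * v) * w′ ≡ (- (v * w′ - v′ * w)) * u′ + (u * w′ - u′ * w) * v′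
  second = solve-∀

det-injective : ∀ u v w w′ → det u v ≢ 0ℤ → det v w ≡ det v w′ → det u w ≡ det u w′ → w ≡ w′
det-injective u v w w′ nondeg e₁ e₂ = •-cancelˡ (det u v) w w′ nondeg (begin
  det u v • w                              ≡⟨ cramer u v w ⟩
  ((- det v w) • u) ⊕ (det u w • v)        ≡⟨ cong₂ (λ s t → ((- s) • u) ⊕ (t • v)) e₁ e₂ ⟩
  ((- det v w′) • u) ⊕ (det u w′ • v)      ≡⟨ cramer u v w′ ⟨
  det u v • w′                             ∎)
  where open ≡-Reasoning

-- Integer affine maps

IsUnit : ℤ → Set
IsUnit δ = (δ ≡ 1ℤ) ⊎ (δ ≡ - 1ℤ)

IsUnit-* : ∀ {δ δ′} → IsUnit δ → IsUnit δ′ → IsUnit (δ * δ′)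
IsUnit-* (inj₁ refl) (inj₁ refl) = inj₁ refl
IsUnit-* (inj₁ refl) (inj₂ refl) = inj₂ refl
IsUnit-* (inj₂ refl) (inj₁ refl) = inj₂ refl
IsUnit-* (inj₂ refl) (inj₂ refl) = inj₁ refl

IsUnit⇒square≡1 : ∀ {δ} → IsUnit δ → δ * δ ≡ 1ℤ
IsUnit⇒square≡1 (inj₁ refl) = refl
IsUnit⇒square≡1 (inj₂ refl) = refl

linear : Aff → Point → Point
linear g (x , y) = (a g * x + b g * y , c g * x + d g * y)

detᵃ : Aff → ℤ
detᵃ g = a g * d g - b g * c g

apply-⊖ : ∀ g P Q → apply g P ⊖ apply g Q ≡ linear g (P ⊖ Q)
apply-⊖ g (x , y) (x′ , y′) =
  cong₂ _,_ (identity (a g) (b g) (e g) x y x′ y′) (identity (c g) (d g) (f g) x y x′ y′)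
  where
  identity : ∀ a b e x y x′ y′ → (a * x + b * y + e) - (a * x′ + b * y′ + e) ≡ a * (x - x′) + b * (y - y′)
  identity = solve-∀

apply-via : ∀ g Z X → apply g Z ≡ apply g X ⊕ linear g (Z ⊖ X)
apply-via g (x , y) (x′ , y′) =
  cong₂ _,_ (identity (a g) (b g) (e g) x y x′ y′) (identity (c g) (d g) (f g) x y x′ y′)
  where
  identity : ∀ a b e x y x′ y′ → a * x + b * y + e ≡ (a * x′ + b * y′ + e) + (a * (x - x′) + b * (y - y′))
  identity = solve-∀

det-linear : ∀ g u v → det (linear g u) (linear g v) ≡ detᵃ g * det u v
det-linear g (x , y) (x′ , y′) = identity (a g) (b g) (c g) (d g) x y x′ y′
  where
  identity : ∀ a b c d x y x′ y′ →
    (a * x + b * y) * (c * x′ + d * y′) - (c * x + d * y) * (a * x′ + b * y′) ≡ (a * d - b * c) * (x * y′ - y * x′)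
  identity = solve-∀

linear-comb : ∀ g p u q v → linear g ((p • u) ⊕ (q • v)) ≡ (p • linear g u) ⊕ (q • linear g v)
linear-comb g p (x , y) q (x′ , y′) =
  cong₂ _,_ (identity (a g) (b g) p x y q x′ y′) (identity (c g) (d g) p x y q x′ y′)
  where
  identity : ∀ a b p x y q x′ y′ →
    a * (p * x + q * x′) + b * (p * y + q * y′) ≡ p * (a * x + b * y) + q * (a * x′ + b * y′)
  identity = solve-∀

linear-• : ∀ g k v → linear g (k • v) ≡ k • linear g v
linear-• g k (x , y) = cong₂ _,_ (identity (a g) (b g) k x y) (identity (c g) (d g) k x y)
  where
  identity : ∀ a b k x y → a * (k * x) + b * (k * y) ≡ k * (a * x + b * y)
  identity = solve-∀

det-apply : ∀ g A B C → det (apply g A ⊖ apply g B) (apply g C ⊖ apply g B) ≡ detᵃ g * det (A ⊖ B) (C ⊖ B)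
det-apply g A B C = trans (cong₂ det (apply-⊖ g A B) (apply-⊖ g C B)) (det-linear g (A ⊖ B) (C ⊖ B))

∣detᵃ*i∣≡∣i∣ : ∀ g i → ∣ detᵃ g * i ∣ ≡ ∣ i ∣
∣detᵃ*i∣≡∣i∣ g i with unimodular g
... | inj₁ δ≡1 rewrite δ≡1 = cong ∣_∣ (*-identityˡ i)
... | inj₂ δ≡-1 rewrite δ≡-1 = trans (cong ∣_∣ (-1*i≡-i i)) (∣-i∣≡∣i∣ i)

ldetDist-apply : ∀ g X Y P → ldetDist (apply g X) (apply g Y) (apply g P) ≡ ldetDist X Y P
ldetDist-apply g X Y P = trans (cong ∣_∣ (det-apply g Y X P)) (∣detᵃ*i∣≡∣i∣ g _)

-- The inverse of x ↦ M x + t is x ↦ δ adj(M) (x - t), where δ = det M = δ⁻¹.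
_⁻¹ : Aff → Aff
g ⁻¹ = record
  { a = δ * d g ; b = δ * (- b g) ; c = δ * (- c g) ; d = δ * a g
  ; e = - (δ * d g * e g + δ * (- b g) * f g)
  ; f = - (δ * (- c g) * e g + δ * a g * f g)
  ; unimodular = subst IsUnit (sym (identity δ (a g) (b g) (c g) (d g)))
                   (IsUnit-* (IsUnit-* (unimodular g) (unimodular g)) (unimodular g))
  }
  where
  δ = detᵃ g
  identity : ∀ δ a b c d → (δ * d) * (δ * a) - (δ * (- b)) * (δ * (- c)) ≡ δ * δ * (a * d - b * c)
  identity = solve-∀

⁻¹-inverseˡ : ∀ g P → apply (g ⁻¹) (apply g P) ≡ P
⁻¹-inverseˡ g (x , y) = cong₂ _,_
  (trans (first δ (a g) (b g) (c g) (d g) (e g) (f g) x y) (δ²*i≡i x))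
  (trans (second δ (a g) (b g) (c g) (d g) (e g) (f g) x y) (δ²*i≡i y))
  where
  δ = detᵃ g
  δ²*i≡i : ∀ i → δ * (a g * d g - b g * c g) * i ≡ i
  δ²*i≡i i rewrite IsUnit⇒square≡1 (unimodular g) = *-identityˡ i
  first : ∀ δ a b c d e f x y →
    (δ * d) * (a * x + b * y + e) + (δ * (- b)) * (c * x + d * y + f) + - (δ * d * e + δ * (- b) * f)
      ≡ δ * (a * d - b * c) * x
  first = solve-∀
  second : ∀ δ a b c d e f x y →
    (δ * (- c)) * (a * x + b * y + e) + (δ * a) * (c * x + d * y + f) + - (δ * (- c) * e + δ * a * f)
      ≡ δ * (a * d - b * c) * y
  second = solve-∀

⁻¹-inverseʳ : ∀ g P → apply g (apply (g ⁻¹) P) ≡ P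
⁻¹-inverseʳ g (x , y) = cong₂ _,_
  (trans (first δ (a g) (b g) (c g) (d g) (e g) (f g) x y) (cancel x (e g)))
  (trans (second δ (a g) (b g) (c g) (d g) (e g) (f g) x y) (cancel y (f g)))
  where
  δ = detᵃ g
  cancel : ∀ i t → δ * (a g * d g - b g * c g) * i - δ * (a g * d g - b g * c g) * t + t ≡ i
  cancel i t rewrite IsUnit⇒square≡1 (unimodular g) = identity i t
    where
    identity : ∀ i t → 1ℤ * i - 1ℤ * t + t ≡ i
    identity = solve-∀
  first : ∀ δ a b c d e f x y →
    a * ((δ * d) * x + (δ * (- b)) * y + - (δ * d * e + δ * (- b) * f))
      + b * ((δ * (- c)) * x + (δ * a) * y + - (δ * (- c) * e + δ * a * f)) + e
      ≡ δ * (a * d - b * c) * x - δ * (a * d - b * c) * e + e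
  first = solve-∀
  second : ∀ δ a b c d e f x y →
    c * ((δ * d) * x + (δ * (- b)) * y + - (δ * d * e + δ * (- b) * f))
      + d * ((δ * (- c)) * x + (δ * a) * y + - (δ * (- c) * e + δ * a * f)) + f
      ≡ δ * (a * d - b * c) * y - δ * (a * d - b * c) * f + f
  second = solve-∀

linear-⁻¹ : ∀ g v → linear (g ⁻¹) (linear g v) ≡ v
linear-⁻¹ g v = begin
  linear (g ⁻¹) (linear g v)                                ≡⟨ cong (linear (g ⁻¹) ∘ linear g) (⊖-identityʳ v) ⟨
  linear (g ⁻¹) (linear g (v ⊖ origin))                     ≡⟨ cong (linear (g ⁻¹)) (apply-⊖ g v origin) ⟨
  linear (g ⁻¹) (apply g v ⊖ apply g origin)                ≡⟨ apply-⊖ (g ⁻¹) (apply g v) (apply g origin) ⟨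
  apply (g ⁻¹) (apply g v) ⊖ apply (g ⁻¹) (apply g origin)  ≡⟨ cong₂ _⊖_ (⁻¹-inverseˡ g v) (⁻¹-inverseˡ g origin) ⟩
  v ⊖ origin                                                ≡⟨ ⊖-identityʳ v ⟩
  v                                                         ∎
  where open ≡-Reasoning

_∘ᵃ_ : Aff → Aff → Aff
g ∘ᵃ h = record
  { a = a g * a h + b g * c h ; b = a g * b h + b g * d h
  ; c = c g * a h + d g * c h ; d = c g * b h + d g * d h
  ; e = a g * e h + b g * f h + e g ; f = c g * e h + d g * f h + f g
  ; unimodular = subst IsUnit (sym (identity (a g) (b g) (c g) (d g) (a h) (b h) (c h) (d h)))
                   (IsUnit-* (unimodular g) (unimodular h))
  }
  where
  identity : ∀ a b c d a′ b′ c′ d′ →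
    (a * a′ + b * c′) * (c * b′ + d * d′) - (a * b′ + b * d′) * (c * a′ + d * c′)
      ≡ (a * d - b * c) * (a′ * d′ - b′ * c′)
  identity = solve-∀

apply-∘ᵃ : ∀ g h P → apply (g ∘ᵃ h) P ≡ apply g (apply h P)
apply-∘ᵃ g h (x , y) = cong₂ _,_
  (identity (a g) (b g) (e g) (a h) (b h) (c h) (d h) (e h) (f h) x y)
  (identity (c g) (d g) (f g) (a h) (b h) (c h) (d h) (e h) (f h) x y)
  where
  identity : ∀ a b e a′ b′ c′ d′ e′ f′ x y →
    (a * a′ + b * c′) * x + (a * b′ + b * d′) * y + (a * e′ + b * f′ + e)
      ≡ a * (a′ * x + b′ * y + e′) + b * (c′ * x + d′ * y + f′) + e
  identity = solve-∀

-- Integer length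

content : Point → ℕ
content (x , y) = gcd ∣ x ∣ ∣ y ∣

content∣content-linear : ∀ g v → content v ∣ℕ content (linear g v)
content∣content-linear g (x , y) = gcd-greatest (∣⇒∣ᵤ (row (a g) (b g))) (∣⇒∣ᵤ (row (c g) (d g)))
  where
  G∣x : + content (x , y) ∣ℤ x
  G∣x = ∣ᵤ⇒∣ (gcd[m,n]∣m (∣ x ∣) (∣ y ∣))
  G∣y : + content (x , y) ∣ℤ y
  G∣y = ∣ᵤ⇒∣ (gcd[m,n]∣n (∣ x ∣) (∣ y ∣))
  row : ∀ p q → + content (x , y) ∣ℤ p * x + q * y
  row p q = ∣m∣n⇒∣m+n (∣n⇒∣m*n p G∣x) (∣n⇒∣m*n q G∣y)

content-linear : ∀ g v → content (linear g v) ≡ content v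
content-linear g v = ∣-antisym
  (subst (content (linear g v) ∣ℕ_) (cong content (linear-⁻¹ g v)) (content∣content-linear (g ⁻¹) (linear g v)))
  (content∣content-linear g v)

lℓ-apply : ∀ g P Q → lℓ (apply g P) (apply g Q) ≡ lℓ P Q
lℓ-apply g P Q = trans (cong content (apply-⊖ g Q P)) (content-linear g (Q ⊖ P))

lℓ-sym : ∀ P Q → lℓ P Q ≡ lℓ Q P
lℓ-sym (x , y) (x′ , y′) = cong₂ gcd (∣i-j∣≡∣j-i∣ x′ x) (∣i-j∣≡∣j-i∣ y′ y)

content-• : ∀ k v → content (k • v) ≡ ∣ k ∣ ℕ.* content v
content-• k (x , y) rewrite abs-* k x | abs-* k y = sym (c*gcd[m,n]≡gcd[cm,cn] (∣ k ∣) (∣ x ∣) (∣ y ∣))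

content≡0⇒origin : ∀ v → content v ≡ 0 → v ≡ origin
content≡0⇒origin (x , y) eq =
  cong₂ _,_ (∣i∣≡0⇒i≡0 (gcd[m,n]≡0⇒m≡0 eq)) (∣i∣≡0⇒i≡0 (gcd[m,n]≡0⇒n≡0 ∣ x ∣ eq))

sameRay-content-injective : ∀ u v → SameRay u v → content u ≡ content v → u ≡ v
sameRay-content-injective u v (p , q , eq) same with content u in cu
... | zero = trans (content≡0⇒origin u cu) (sym (content≡0⇒origin v (sym same)))
... | suc G = •-cancelˡ (+ suc p) u v (λ ()) (subst (λ r → (+ suc p) • u ≡ (+ suc r) • v) (sym p≡q) eq)
  where
  p≡q : p ≡ q
  p≡q = ℕP.suc-injective (ℕP.*-cancelʳ-≡ (suc p) (suc q) (suc G) (begin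
    suc p ℕ.* suc G            ≡⟨ cong (suc p ℕ.*_) cu ⟨
    suc p ℕ.* content u        ≡⟨ content-• (+ suc p) u ⟨
    content ((+ suc p) • u)    ≡⟨ cong content eq ⟩
    content ((+ suc q) • v)    ≡⟨ content-• (+ suc q) v ⟩
    suc q ℕ.* content v        ≡⟨ cong (suc q ℕ.*_) same ⟨
    suc q ℕ.* suc G            ∎))
    where open ≡-Reasoning

abs-as-multiple : ∀ x → Σ ℤ λ s → + ∣ x ∣ ≡ s * x
abs-as-multiple (+ n) = 1ℤ , sym (*-identityˡ (+ n))
abs-as-multiple -[1+ n ] = -1ℤ , sym (-1*i≡-i -[1+ n ])

m+n≡o⇒m≡o-n : ∀ {m n o} → m ℕ.+ n ≡ o → + m ≡ + o - + n
m+n≡o⇒m≡o-n {m} {n} refl = begin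
  + m                  ≡⟨ identity (+ m) (+ n) ⟩
  + m + + n - + n      ≡⟨ cong (_- + n) (pos-+ m n) ⟨
  + (m ℕ.+ n) - + n    ∎
  where
  open ≡-Reasoning
  identity : ∀ i j → i ≡ i + j - j
  identity = solve-∀

bezout : ∀ x y → Σ ℤ λ α → Σ ℤ λ β → α * x + β * y ≡ + content (x , y)
bezout x y with abs-as-multiple x | abs-as-multiple y | Bézout.identity (gcd-GCD ∣ x ∣ ∣ y ∣)
... | s , ∣x∣≡sx | t , ∣y∣≡ty | Bézout.+- X Y eq = + X * s , - (+ Y * t) , (begin
  + X * s * x + - (+ Y * t) * y      ≡⟨ identity (+ X) s x (+ Y) t y ⟩
  + X * (s * x) - + Y * (t * y)      ≡⟨ cong₂ (λ p q → + X * p - + Y * q) ∣x∣≡sx ∣y∣≡ty ⟨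
  + X * + ∣ x ∣ - + Y * + ∣ y ∣      ≡⟨ cong₂ _-_ (pos-* X ∣ x ∣) (pos-* Y ∣ y ∣) ⟨
  + (X ℕ.* ∣ x ∣) - + (Y ℕ.* ∣ y ∣)  ≡⟨ m+n≡o⇒m≡o-n eq ⟨
  + content (x , y)                  ∎)
  where
  open ≡-Reasoning
  identity : ∀ u s x v t y → u * s * x + - (v * t) * y ≡ u * (s * x) - v * (t * y)
  identity = solve-∀
... | s , ∣x∣≡sx | t , ∣y∣≡ty | Bézout.-+ X Y eq = - (+ X * s) , + Y * t , (begin
  - (+ X * s) * x + + Y * t * y      ≡⟨ identity (+ X) s x (+ Y) t y ⟩
  + Y * (t * y) - + X * (s * x)      ≡⟨ cong₂ (λ p q → + Y * q - + X * p) ∣x∣≡sx ∣y∣≡ty ⟨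
  + Y * + ∣ y ∣ - + X * + ∣ x ∣      ≡⟨ cong₂ _-_ (pos-* Y ∣ y ∣) (pos-* X ∣ x ∣) ⟨
  + (Y ℕ.* ∣ y ∣) - + (X ℕ.* ∣ x ∣)  ≡⟨ m+n≡o⇒m≡o-n eq ⟨
  + content (x , y)                  ∎)
  where
  open ≡-Reasoning
  identity : ∀ u s x v t y → - (u * s) * x + v * t * y ≡ v * (t * y) - u * (s * x)
  identity = solve-∀

primitive-decomposition : ∀ u G′ → content u ≡ suc G′ →
  Σ Point λ e → u ≡ (+[1+ G′ ]) • e × Σ ℤ λ α → Σ ℤ λ β → α * proj₁ e + β * proj₂ e ≡ 1ℤ
primitive-decomposition (x , y) G′ eq
  with ∣ᵤ⇒∣ {+[1+ G′ ]} {x} (subst (_∣ℕ ∣ x ∣) eq (gcd[m,n]∣m (∣ x ∣) (∣ y ∣)))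
     | ∣ᵤ⇒∣ {+[1+ G′ ]} {y} (subst (_∣ℕ ∣ y ∣) eq (gcd[m,n]∣n (∣ x ∣) (∣ y ∣)))
     | bezout x y
... | divides e₁ x≡e₁G | divides e₂ y≡e₂G | α , β , αx+βy≡G =
  (e₁ , e₂) , cong₂ _,_ (trans x≡e₁G (*-comm e₁ G)) (trans y≡e₂G (*-comm e₂ G)) , α , β ,
  *-cancelˡ-≡ G (α * e₁ + β * e₂) 1ℤ (begin
    G * (α * e₁ + β * e₂)        ≡⟨ identity G α β e₁ e₂ ⟩
    α * (e₁ * G) + β * (e₂ * G)  ≡⟨ cong₂ (λ p q → α * p + β * q) x≡e₁G y≡e₂G ⟨
    α * x + β * y                ≡⟨ trans αx+βy≡G (cong +_ eq) ⟩
    G                            ≡⟨ *-identityʳ G ⟨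
    G * 1ℤ                       ∎)
  where
  G = +[1+ G′ ]
  open ≡-Reasoning
  identity : ∀ G α β e₁ e₂ → G * (α * e₁ + β * e₂) ≡ α * (e₁ * G) + β * (e₂ * G)
  identity = solve-∀

-- With e = (C - B)/G primitive, the Bézout pair (α, β) of e and the row (-e₂, e₁) form a
-- unimodular matrix sending e to (1, 0).
primitive-frame : ∀ B C G′ → content (C ⊖ B) ≡ suc G′ →
  Σ Aff λ g → apply g B ≡ origin × apply g C ≡ (+[1+ G′ ] , 0ℤ)
primitive-frame (B₁ , B₂) C G′ eq = g , gB≡origin , (begin
  apply g C                                      ≡⟨ apply-via g C (B₁ , B₂) ⟩
  apply g (B₁ , B₂) ⊕ linear g (C ⊖ (B₁ , B₂))   ≡⟨ cong₂ _⊕_ gB≡origin (cong (linear g) u≡Ge) ⟩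
  origin ⊕ linear g (G • (e₁ , e₂))              ≡⟨ cong (origin ⊕_) (linear-• g G (e₁ , e₂)) ⟩
  origin ⊕ (G • linear g (e₁ , e₂))
    ≡⟨ cong (λ t → origin ⊕ (G • (t , - e₂ * e₁ + e₁ * e₂))) αe₁+βe₂≡1 ⟩
  origin ⊕ (G • (1ℤ , - e₂ * e₁ + e₁ * e₂))      ≡⟨ cong₂ _,_ (identity₁ G) (identity₂ G e₁ e₂) ⟩
  (G , 0ℤ)                                       ∎)
  where
  G = +[1+ G′ ]
  decomposition = primitive-decomposition (C ⊖ (B₁ , B₂)) G′ eq
  e₁ = proj₁ (proj₁ decomposition)
  e₂ = proj₂ (proj₁ decomposition)
  u≡Ge : C ⊖ (B₁ , B₂) ≡ G • (e₁ , e₂)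
  u≡Ge = proj₁ (proj₂ decomposition)
  α = proj₁ (proj₂ (proj₂ decomposition))
  β = proj₁ (proj₂ (proj₂ (proj₂ decomposition)))
  αe₁+βe₂≡1 : α * e₁ + β * e₂ ≡ 1ℤ
  αe₁+βe₂≡1 = proj₂ (proj₂ (proj₂ (proj₂ decomposition)))
  unimodularity : ∀ α β e₁ e₂ → α * e₁ - β * - e₂ ≡ α * e₁ + β * e₂
  unimodularity = solve-∀
  g : Aff
  g = record
    { a = α ; b = β ; c = - e₂ ; d = e₁
    ; e = - (α * B₁ + β * B₂) ; f = - (- e₂ * B₁ + e₁ * B₂)
    ; unimodular = inj₁ (trans (unimodularity α β e₁ e₂) αe₁+βe₂≡1)
    }
  gB≡origin : apply g (B₁ , B₂) ≡ origin
  gB≡origin = cong₂ _,_ (+-inverseʳ (α * B₁ + β * B₂)) (+-inverseʳ (- e₂ * B₁ + e₁ * B₂))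
  open ≡-Reasoning
  identity₁ : ∀ G → 0ℤ + G * 1ℤ ≡ G
  identity₁ = solve-∀
  identity₂ : ∀ G e₁ e₂ → 0ℤ + G * (- e₂ * e₁ + e₁ * e₂) ≡ 0ℤ
  identity₂ = solve-∀

translation-to-origin : ∀ B → Σ Aff λ g → apply g B ≡ origin
translation-to-origin (B₁ , B₂) =
  record { a = 1ℤ ; b = 0ℤ ; c = 0ℤ ; d = 1ℤ ; e = - B₁ ; f = - B₂ ; unimodular = inj₁ refl } ,
  cong₂ _,_ (first B₁ B₂) (second B₁ B₂)
  where
  first : ∀ x y → 1ℤ * x + 0ℤ * y + - x ≡ 0ℤ
  first = solve-∀
  second : ∀ x y → 0ℤ * x + 1ℤ * y + - y ≡ 0ℤ
  second = solve-∀

frame : ∀ B C → Σ Aff λ g → apply g B ≡ origin × apply g C ≡ (+ content (C ⊖ B) , 0ℤ)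
frame B C with content (C ⊖ B) in eq
... | suc G′ = primitive-frame B C G′ eq
... | zero with translation-to-origin B
...   | t , tB≡origin = t , tB≡origin , trans (cong (apply t) C≡B) tB≡origin
  where
  C≡B : C ≡ B
  C≡B = ⊖-cancelʳ C B B (trans (content≡0⇒origin (C ⊖ B) eq) (sym (⊖-self B)))

-- The points B′ and C′

subst₄ : (R : Point → Point → Point → Point → Set) → ∀ {A A′ B B′ C C′ P P′} →
  A ≡ A′ → B ≡ B′ → C ≡ C′ → P ≡ P′ → R A B C P → R A′ B′ C′ P′
subst₄ R refl refl refl refl r = r

Invariant : (Point → Point → Point → Point → Set) → Set
Invariant R = ∀ g {A B C P} → R A B C P → R (apply g A) (apply g B) (apply g C) (apply g P)

invariant-reflect : ∀ R → Invariant R →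
  ∀ g {A B C P} → R (apply g A) (apply g B) (apply g C) (apply g P) → R A B C P
invariant-reflect R invariant g {A} {B} {C} {P} r =
  subst₄ R (⁻¹-inverseˡ g A) (⁻¹-inverseˡ g B) (⁻¹-inverseˡ g C) (⁻¹-inverseˡ g P) (invariant (g ⁻¹) r)

InAngle-apply : Invariant InAngle
InAngle-apply g {A} {B} {C} {P} (p , q , r , eq) = p , q , r , (begin
  (+ suc r) • (apply g P ⊖ apply g B)                      ≡⟨ cong ((+ suc r) •_) (apply-⊖ g P B) ⟩
  (+ suc r) • linear g (P ⊖ B)                             ≡⟨ linear-• g (+ suc r) (P ⊖ B) ⟨
  linear g ((+ suc r) • (P ⊖ B))                           ≡⟨ cong (linear g) eq ⟩
  linear g (((+ p) • (A ⊖ B)) ⊕ ((+ q) • (C ⊖ B)))         ≡⟨ linear-comb g (+ p) (A ⊖ B) (+ q) (C ⊖ B) ⟩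
  ((+ p) • linear g (A ⊖ B)) ⊕ ((+ q) • linear g (C ⊖ B))  ≡⟨ cong₂ (λ u v → ((+ p) • u) ⊕ ((+ q) • v))
                                                                    (apply-⊖ g A B) (apply-⊖ g C B) ⟨
  ((+ p) • (apply g A ⊖ apply g B)) ⊕ ((+ q) • (apply g C ⊖ apply g B)) ∎)
  where open ≡-Reasoning

UnitDist-apply : Invariant (λ _ → UnitDist)
UnitDist-apply g {_} {B} {C} {P} ud = trans (ldetDist-apply g B C P) (trans ud (sym (lℓ-apply g B C)))

IsB′-apply : Invariant IsB′
IsB′-apply g {A} {B} {C} {P} (inAngle , unitDist , closest) =
  InAngle-apply g inAngle , UnitDist-apply g {A} unitDist , closest′
  where
  closest′ : ∀ Q → InAngle (apply g A) (apply g B) (apply g C) Q → UnitDist (apply g B) (apply g C) Q →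
    ldetDist (apply g B) (apply g A) (apply g P) ℕ.≤ ldetDist (apply g B) (apply g A) Q
  closest′ Q inAngleQ unitDistQ = subst₂ ℕ._≤_ (sym (ldetDist-apply g B A P)) Q′-dist
    (closest Q′
      (invariant-reflect InAngle InAngle-apply g (subst (InAngle (apply g A) (apply g B) (apply g C)) Q≡gQ′ inAngleQ))
      (invariant-reflect (λ _ → UnitDist) UnitDist-apply g {A} (subst (UnitDist (apply g B) (apply g C)) Q≡gQ′ unitDistQ)))
    where
    Q′ = apply (g ⁻¹) Q
    Q≡gQ′ : Q ≡ apply g Q′
    Q≡gQ′ = sym (⁻¹-inverseʳ g Q)
    Q′-dist : ldetDist B A Q′ ≡ ldetDist (apply g B) (apply g A) Q
    Q′-dist = trans (sym (ldetDist-apply g B A Q′)) (cong (ldetDist (apply g B) (apply g A)) (sym Q≡gQ′))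

InAngle-swap : ∀ A B C P → InAngle A B C P → InAngle C B A P
InAngle-swap A B C P (p , q , r , eq) = q , p , r , trans eq (⊕-comm ((+ p) • (A ⊖ B)) ((+ q) • (C ⊖ B)))
  where
  ⊕-comm : ∀ u v → u ⊕ v ≡ v ⊕ u
  ⊕-comm (x , y) (x′ , y′) = cong₂ _,_ (+-comm x x′) (+-comm y y′)

ldetDist-swap : ∀ B C P → ldetDist C B P ≡ ldetDist B C P
ldetDist-swap (b , b′) (c , c′) (p , p′) =
  trans (cong ∣_∣ (identity b b′ c c′ p p′)) (∣-i∣≡∣i∣ ((c - b) * (p′ - b′) - (c′ - b′) * (p - b)))
  where
  identity : ∀ b b′ c c′ p p′ →
    (b - c) * (p′ - c′) - (b′ - c′) * (p - c) ≡ - ((c - b) * (p′ - b′) - (c′ - b′) * (p - b))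
  identity = solve-∀

UnitDist-swap : ∀ B C P → UnitDist B C P → UnitDist C B P
UnitDist-swap B C P ud = trans (ldetDist-swap B C P) (trans ud (lℓ-sym B C))

IsC′⇒IsB′ : ∀ B C D P → IsC′ B C D P → IsB′ D C B P
IsC′⇒IsB′ B C D P (inAngle , unitDist , closest) =
  InAngle-swap B C D P inAngle , UnitDist-swap B C P unitDist ,
  λ Q inAngleQ unitDistQ → closest Q (InAngle-swap D C B Q inAngleQ) (UnitDist-swap C B Q unitDistQ)

IsB′⇒IsC′ : ∀ B C D P → IsB′ D C B P → IsC′ B C D P
IsB′⇒IsC′ B C D P (inAngle , unitDist , closest) =
  InAngle-swap D C B P inAngle , UnitDist-swap C B P unitDist ,
  λ Q inAngleQ unitDistQ → closest Q (InAngle-swap B C D Q inAngleQ) (UnitDist-swap B C Q unitDistQ)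

IsC′-apply : Invariant IsC′
IsC′-apply g {B} {C} {D} {P} isC′ =
  IsB′⇒IsC′ (apply g B) (apply g C) (apply g D) (apply g P) (IsB′-apply g (IsC′⇒IsB′ B C D P isC′))

-- x is 0 or has the sign of D.
OnSideOf : ℤ → ℤ → Set
OnSideOf D x = Σ ℕ λ r → Σ ℕ λ p → + suc r * x ≡ + p * D

SameSign : ℤ → ℤ → Set
SameSign D D′ = (0ℤ < D × 0ℤ < D′) ⊎ (D < 0ℤ × D′ < 0ℤ)

SameSign-refl : ∀ {D} → D ≢ 0ℤ → SameSign D D
SameSign-refl {+0} D≢0 = ⊥-elim (D≢0 refl)
SameSign-refl {+[1+ n ]} _ = inj₁ (+<+ (s≤s z≤n) , +<+ (s≤s z≤n))
SameSign-refl { -[1+ n ]} _ = inj₂ (-<+ , -<+)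

OnSideOf-pos⇒nonneg : ∀ {D x} → 0ℤ < D → OnSideOf D x → 0ℤ ≤ x
OnSideOf-pos⇒nonneg {x = + n} _ _ = +≤+ z≤n
OnSideOf-pos⇒nonneg {+0} { -[1+ m ]} (+<+ ()) _
OnSideOf-pos⇒nonneg {+[1+ n ]} { -[1+ m ]} _ (r , p , eq) with trans eq (sym (pos-* p (suc n)))
... | ()

OnSideOf-neg : ∀ {D x} → OnSideOf D x → OnSideOf (- D) (- x)
OnSideOf-neg {D} {x} (r , p , eq) =
  r , p , trans (sym (neg-distribʳ-* (+ suc r) x)) (trans (cong -_ eq) (neg-distribʳ-* (+ p) D))

OnSideOf-abs-injective : ∀ {D D′ x x′} → SameSign D D′ → OnSideOf D x → OnSideOf D′ x′ →
  ∣ x ∣ ≡ ∣ x′ ∣ → x ≡ x′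
OnSideOf-abs-injective {x = x} {x′} (inj₁ (0<D , 0<D′)) side side′ ∣x∣≡∣x′∣ = begin
  x        ≡⟨ 0≤i⇒+∣i∣≡i (OnSideOf-pos⇒nonneg 0<D side) ⟨
  + ∣ x ∣   ≡⟨ cong +_ ∣x∣≡∣x′∣ ⟩
  + ∣ x′ ∣  ≡⟨ 0≤i⇒+∣i∣≡i (OnSideOf-pos⇒nonneg 0<D′ side′) ⟩
  x′       ∎
  where open ≡-Reasoning
OnSideOf-abs-injective {x = x} {x′} (inj₂ (D<0 , D′<0)) side side′ ∣x∣≡∣x′∣ =
  neg-injective (OnSideOf-abs-injective (inj₁ (neg-mono-< D<0 , neg-mono-< D′<0))
    (OnSideOf-neg side) (OnSideOf-neg side′)
    (trans (∣-i∣≡∣i∣ x) (trans ∣x∣≡∣x′∣ (sym (∣-i∣≡∣i∣ x′)))))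

-- Seen from a direction x parallel to the edge BA, every point of ∠ABC lies on the side of C.
InAngle⇒OnSideOf : ∀ x A B C P → det x (A ⊖ B) ≡ 0ℤ → InAngle A B C P →
  OnSideOf (det x (C ⊖ B)) (det x (P ⊖ B))
InAngle⇒OnSideOf x A B C P x∥BA (p , q , r , eq) = r , q , (begin
  + suc r * det x (P ⊖ B)                      ≡⟨ det-•ʳ x (+ suc r) (P ⊖ B) ⟨
  det x ((+ suc r) • (P ⊖ B))                  ≡⟨ cong (det x) eq ⟩
  det x (((+ p) • (A ⊖ B)) ⊕ ((+ q) • (C ⊖ B))) ≡⟨ det-combʳ x (+ p) (A ⊖ B) (+ q) (C ⊖ B) ⟩
  + p * det x (A ⊖ B) + + q * det x (C ⊖ B)    ≡⟨ cong (λ t → + p * t + + q * det x (C ⊖ B)) x∥BA ⟩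
  + p * 0ℤ + + q * det x (C ⊖ B)               ≡⟨ cong (_+ + q * det x (C ⊖ B)) (*-zeroʳ (+ p)) ⟩
  0ℤ + + q * det x (C ⊖ B)                     ≡⟨ +-identityˡ _ ⟩
  + q * det x (C ⊖ B)                          ∎)
  where open ≡-Reasoning

det-⊖-flipˡ : ∀ X Y v → det (Y ⊖ X) v ≡ - det (X ⊖ Y) v
det-⊖-flipˡ (x , x′) (y , y′) (v , v′) = identity x x′ y y′ v v′
  where
  identity : ∀ x x′ y y′ v v′ → (y - x) * v′ - (y′ - x′) * v ≡ - ((x - y) * v′ - (x′ - y′) * v)
  identity = solve-∀

det-⊖-shift : ∀ u Q P B → det u (Q ⊖ P) ≡ det u (Q ⊖ B) - det u (P ⊖ B)
det-⊖-shift (u , u′) (q , q′) (p , p′) (b , b′) = identity u u′ q q′ p p′ b b′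
  where
  identity : ∀ u u′ q q′ p p′ b b′ →
    u * (q′ - p′) - u′ * (q - p) ≡ (u * (q′ - b′) - u′ * (q - b)) - (u * (p′ - b′) - u′ * (p - b))
  identity = solve-∀

det-⊖-reverse : ∀ X Y → det (Y ⊖ X) (X ⊖ Y) ≡ 0ℤ
det-⊖-reverse X Y = trans (det-⊖-flipˡ X Y (X ⊖ Y)) (cong -_ (det-self (X ⊖ Y)))

B′-unique : ∀ A B C P P′ → det (A ⊖ B) (C ⊖ B) ≢ 0ℤ → IsB′ A B C P → IsB′ A B C P′ → P ≡ P′
B′-unique A B C P P′ nondeg (inAngle , unitDist , closest) (inAngle′ , unitDist′ , closest′) =
  ⊖-cancelʳ P P′ B (det-injective BA BC (P ⊖ B) (P′ ⊖ B) nondeg along-BC along-BA)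
  where
  BA = A ⊖ B
  BC = C ⊖ B
  along-BC : det BC (P ⊖ B) ≡ det BC (P′ ⊖ B)
  along-BC = OnSideOf-abs-injective (SameSign-refl (λ eq → nondeg (trans (det-antisym BA BC) (cong -_ eq))))
    (InAngle⇒OnSideOf BC C B A P (det-self BC) (InAngle-swap A B C P inAngle))
    (InAngle⇒OnSideOf BC C B A P′ (det-self BC) (InAngle-swap A B C P′ inAngle′))
    (trans unitDist (sym unitDist′))
  along-BA : det BA (P ⊖ B) ≡ det BA (P′ ⊖ B)
  along-BA = OnSideOf-abs-injective (SameSign-refl nondeg)
    (InAngle⇒OnSideOf BA A B C P (det-self BA) inAngle) (InAngle⇒OnSideOf BA A B C P′ (det-self BA) inAngle′)
    (ℕP.≤-antisym (closest P′ inAngle′ unitDist′) (closest′ P inAngle unitDist))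

C′-unique : ∀ B C D P P′ → det (D ⊖ C) (B ⊖ C) ≢ 0ℤ → IsC′ B C D P → IsC′ B C D P′ → P ≡ P′
C′-unique B C D P P′ nondeg isC′ isC′′ =
  B′-unique D C B P P′ nondeg (IsC′⇒IsB′ B C D P isC′) (IsC′⇒IsB′ B C D P′ isC′′)

SameSign-neg : ∀ {D D′} → SameSign D D′ → SameSign (- D) (- D′)
SameSign-neg (inj₁ (0<D , 0<D′)) = inj₂ (neg-mono-< 0<D , neg-mono-< 0<D′)
SameSign-neg (inj₂ (D<0 , D′<0)) = inj₁ (neg-mono-< D<0 , neg-mono-< D′<0)

SameSign-unit : ∀ {δ D D′} → IsUnit δ → SameSign D D′ → SameSign (δ * D) (δ * D′)
SameSign-unit {D = D} {D′} (inj₁ refl) same rewrite *-identityˡ D | *-identityˡ D′ = same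
SameSign-unit {D = D} {D′} (inj₂ refl) same rewrite -1*i≡-i D | -1*i≡-i D′ = SameSign-neg same

SameSign⇒≢0 : ∀ {D D′} → SameSign D D′ → D ≢ 0ℤ × D′ ≢ 0ℤ
SameSign⇒≢0 (inj₁ (0<D , 0<D′)) = ≢-sym (<⇒≢ 0<D) , ≢-sym (<⇒≢ 0<D′)
SameSign⇒≢0 (inj₂ (D<0 , D′<0)) = <⇒≢ D<0 , <⇒≢ D′<0

-- On consecutive angles of a broken line this is LocallyConvex unfolded.
SameOrientation : Point → Point → Point → Point → Set
SameOrientation W X Y Z = SameSign (det (W ⊖ X) (Y ⊖ X)) (det (X ⊖ Y) (Z ⊖ Y))

SameOrientation-apply : Invariant SameOrientation
SameOrientation-apply g {W} {X} {Y} {Z} same =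
  subst₂ SameSign (sym (det-apply g W X Y)) (sym (det-apply g X Y Z)) (SameSign-unit (unimodular g) same)

-- B′ and C′ lie on the same side of XY, by the orientation, and both at unit distance from it.
B′-C′-same-height : ∀ W X Y Z P Q → SameOrientation W X Y Z → IsB′ W X Y P → IsC′ X Y Z Q →
  det (Y ⊖ X) (P ⊖ X) ≡ det (Y ⊖ X) (Q ⊖ X)
B′-C′-same-height W X Y Z P Q same (inAngleP , unitDistP , _) (inAngleQ , unitDistQ , _) =
  trans (OnSideOf-abs-injective sides sideP sideQ (trans unitDistP (trans (sym unitDistQ) (cong ∣_∣ Q-height))))
        (sym Q-height)
  where
  XY = Y ⊖ X
  sideP : OnSideOf (det XY (W ⊖ X)) (det XY (P ⊖ X))
  sideP = InAngle⇒OnSideOf XY Y X W P (det-self XY) (InAngle-swap W X Y P inAngleP)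
  sideQ : OnSideOf (det XY (Z ⊖ Y)) (det XY (Q ⊖ Y))
  sideQ = InAngle⇒OnSideOf XY X Y Z Q (det-⊖-reverse X Y) inAngleQ
  sides : SameSign (det XY (W ⊖ X)) (det XY (Z ⊖ Y))
  sides = subst₂ SameSign (sym (det-antisym XY (W ⊖ X))) (sym (det-⊖-flipˡ X Y (Z ⊖ Y))) (SameSign-neg same)
  Q-height : det XY (Q ⊖ X) ≡ det XY (Q ⊖ Y)
  Q-height = begin
    det XY (Q ⊖ X)                     ≡⟨ det-⊖-shift XY Q X Y ⟩
    det XY (Q ⊖ Y) - det XY (X ⊖ Y)    ≡⟨ cong (λ t → det XY (Q ⊖ Y) - t) (det-⊖-reverse X Y) ⟩
    det XY (Q ⊖ Y) - 0ℤ                ≡⟨ +-identityʳ _ ⟩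
    det XY (Q ⊖ Y)                     ∎
    where open ≡-Reasoning

B′C′∥BC : ∀ W X Y Z P Q → SameOrientation W X Y Z → IsB′ W X Y P → IsC′ X Y Z Q → det (Y ⊖ X) (Q ⊖ P) ≡ 0ℤ
B′C′∥BC W X Y Z P Q same isB′ isC′ =
  trans (det-⊖-shift (Y ⊖ X) Q P X) (i≡j⇒i-j≡0 (sym (B′-C′-same-height W X Y Z P Q same isB′ isC′)))

-- Chord curvature

-- The factor sgn⟨u,v⟩ · lℓ(v) of the chord curvature, for v parallel to u.
signedLength : Point → Point → ℤ
signedLength u v = sgnℤ (dot u v) * + content v

sgnℤ-* : ∀ i j → sgnℤ (i * j) ≡ sgnℤ i * sgnℤ j
sgnℤ-* i +0 rewrite *-zeroʳ i | *-zeroʳ (sgnℤ i) = refl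
sgnℤ-* +0 +[1+ n ] = refl
sgnℤ-* +0 -[1+ n ] = refl
sgnℤ-* +[1+ m ] +[1+ n ] = refl
sgnℤ-* +[1+ m ] -[1+ n ] = refl
sgnℤ-* -[1+ m ] +[1+ n ] = refl
sgnℤ-* -[1+ m ] -[1+ n ] = refl

sgnℤ-pos : ∀ {i} → 0ℤ < i → sgnℤ i ≡ 1ℤ
sgnℤ-pos {+0} (+<+ ())
sgnℤ-pos {+[1+ n ]} _ = refl

sgnℤ*∣i∣≡i : ∀ i → sgnℤ i * + ∣ i ∣ ≡ i
sgnℤ*∣i∣≡i +0 = refl
sgnℤ*∣i∣≡i +[1+ n ] = *-identityˡ _
sgnℤ*∣i∣≡i -[1+ n ] = -1*i≡-i +[1+ n ]

0≤i*i : ∀ i → 0ℤ ≤ i * i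
0≤i*i +0 = +≤+ z≤n
0≤i*i +[1+ n ] = +≤+ z≤n
0≤i*i -[1+ n ] = +≤+ z≤n

dot-self-pos : ∀ u → content u ≢ 0 → 0ℤ < dot u u
dot-self-pos (+0 , +0) u≢0 = ⊥-elim (u≢0 gcd[0,0]≡0)
dot-self-pos (+[1+ n ] , y) _ = +-mono-<-≤ (+<+ (s≤s z≤n)) (0≤i*i y)
dot-self-pos (-[1+ n ] , y) _ = +-mono-<-≤ (+<+ (s≤s z≤n)) (0≤i*i y)
dot-self-pos (+0 , +[1+ n ]) _ = +<+ (s≤s z≤n)
dot-self-pos (+0 , -[1+ n ]) _ = +<+ (s≤s z≤n)

parallel⇒multiple : ∀ u v → det u v ≡ 0ℤ → Σ ℤ λ t → (+ content u) • v ≡ t • u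
parallel⇒multiple (u , u′) (v , v′) u∥v = α * v + β * v′ , cong₂ _,_
  (begin
    + content (u , u′) * v                          ≡⟨ cong (_* v) αu+βu′≡G ⟨
    (α * u + β * u′) * v                           ≡⟨ first α β u u′ v v′ ⟩
    (α * v + β * v′) * u - β * (u * v′ - u′ * v)   ≡⟨ cong (λ d → (α * v + β * v′) * u - β * d) u∥v ⟩
    (α * v + β * v′) * u - β * 0ℤ                  ≡⟨ cancel ((α * v + β * v′) * u) β ⟩
    (α * v + β * v′) * u                           ∎)
  (begin
    + content (u , u′) * v′                         ≡⟨ cong (_* v′) αu+βu′≡G ⟨
    (α * u + β * u′) * v′                          ≡⟨ second α β u u′ v v′ ⟩
    (α * v + β * v′) * u′ + α * (u * v′ - u′ * v)  ≡⟨ cong (λ d → (α * v + β * v′) * u′ + α * d) u∥v ⟩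
    (α * v + β * v′) * u′ + α * 0ℤ                 ≡⟨ cancel′ ((α * v + β * v′) * u′) α ⟩
    (α * v + β * v′) * u′                          ∎)
  where
  open ≡-Reasoning
  α = proj₁ (bezout u u′)
  β = proj₁ (proj₂ (bezout u u′))
  αu+βu′≡G : α * u + β * u′ ≡ + content (u , u′)
  αu+βu′≡G = proj₂ (proj₂ (bezout u u′))
  first : ∀ α β u u′ v v′ → (α * u + β * u′) * v ≡ (α * v + β * v′) * u - β * (u * v′ - u′ * v)
  first = solve-∀
  second : ∀ α β u u′ v v′ → (α * u + β * u′) * v′ ≡ (α * v + β * v′) * u′ + α * (u * v′ - u′ * v)
  second = solve-∀
  cancel : ∀ i k → i - k * 0ℤ ≡ i
  cancel = solve-∀
  cancel′ : ∀ i k → i + k * 0ℤ ≡ i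
  cancel′ = solve-∀

signedLength-of-multiple : ∀ u v t → content u ≢ 0 → (+ content u) • v ≡ t • u → signedLength u v ≡ t
signedLength-of-multiple u v t u≢0 Gv≡tu = begin
  sgnℤ (dot u v) * + content v   ≡⟨ cong₂ (λ s n → s * + n) sign-dot length ⟩
  sgnℤ t * + ∣ t ∣               ≡⟨ sgnℤ*∣i∣≡i t ⟩
  t                              ∎
  where
  open ≡-Reasoning
  G = content u
  instance _ = ℕ.≢-nonZero u≢0
  length : content v ≡ ∣ t ∣
  length = ℕP.*-cancelˡ-≡ (content v) ∣ t ∣ G (begin
    G ℕ.* content v          ≡⟨ content-• (+ G) v ⟨
    content ((+ G) • v)      ≡⟨ cong content Gv≡tu ⟩
    content (t • u)          ≡⟨ content-• t u ⟩
    ∣ t ∣ ℕ.* G              ≡⟨ ℕP.*-comm ∣ t ∣ G ⟩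
    G ℕ.* ∣ t ∣              ∎)
  sign-dot : sgnℤ (dot u v) ≡ sgnℤ t
  sign-dot = begin
    sgnℤ (dot u v)                        ≡⟨ *-identityˡ _ ⟨
    1ℤ * sgnℤ (dot u v)                   ≡⟨ cong (_* sgnℤ (dot u v)) (sgnℤ-pos (+<+ (ℕP.n≢0⇒n>0 u≢0))) ⟨
    sgnℤ (+ G) * sgnℤ (dot u v)           ≡⟨ sgnℤ-* (+ G) (dot u v) ⟨
    sgnℤ (+ G * dot u v)                  ≡⟨ cong sgnℤ (dot-•ʳ u (+ G) v) ⟨
    sgnℤ (dot u ((+ G) • v))              ≡⟨ cong (sgnℤ ∘ dot u) Gv≡tu ⟩
    sgnℤ (dot u (t • u))                  ≡⟨ cong sgnℤ (dot-•ʳ u t u) ⟩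
    sgnℤ (t * dot u u)                    ≡⟨ sgnℤ-* t (dot u u) ⟩
    sgnℤ t * sgnℤ (dot u u)               ≡⟨ cong (sgnℤ t *_) (sgnℤ-pos (dot-self-pos u u≢0)) ⟩
    sgnℤ t * 1ℤ                           ≡⟨ *-identityʳ _ ⟩
    sgnℤ t                                ∎

parallel-signedLength : ∀ u v → content u ≢ 0 → det u v ≡ 0ℤ → (+ content u) • v ≡ signedLength u v • u
parallel-signedLength u v u≢0 u∥v = trans Gv≡tu (cong (_• u) (sym (signedLength-of-multiple u v t u≢0 Gv≡tu)))
  where
  t = proj₁ (parallel⇒multiple u v u∥v)
  Gv≡tu = proj₂ (parallel⇒multiple u v u∥v)

signedLength-linear : ∀ g u v → content u ≢ 0 → det u v ≡ 0ℤ →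
  signedLength (linear g u) (linear g v) ≡ signedLength u v
signedLength-linear g u v u≢0 u∥v = trans
  (signedLength-of-multiple (linear g u) (linear g v) t (subst (_≢ 0) (sym (content-linear g u)) u≢0) (begin
    (+ content (linear g u)) • linear g v   ≡⟨ cong (λ n → (+ n) • linear g v) (content-linear g u) ⟩
    (+ content u) • linear g v              ≡⟨ linear-• g (+ content u) v ⟨
    linear g ((+ content u) • v)            ≡⟨ cong (linear g) Gv≡tu ⟩
    linear g (t • u)                        ≡⟨ linear-• g t u ⟩
    t • linear g u                          ∎))
  (sym (signedLength-of-multiple u v t u≢0 Gv≡tu))
  where
  open ≡-Reasoning
  t = proj₁ (parallel⇒multiple u v u∥v)
  Gv≡tu = proj₂ (parallel⇒multiple u v u∥v)

signedLength-injective : ∀ u v w → content u ≢ 0 → det u v ≡ 0ℤ → det u w ≡ 0ℤ →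
  signedLength u v ≡ signedLength u w → v ≡ w
signedLength-injective u v w u≢0 u∥v u∥w same = •-cancelˡ (+ content u) v w (u≢0 ∘ +-injective) (begin
  (+ content u) • v        ≡⟨ parallel-signedLength u v u≢0 u∥v ⟩
  signedLength u v • u     ≡⟨ cong (_• u) same ⟩
  signedLength u w • u     ≡⟨ parallel-signedLength u w u≢0 u∥w ⟨
  (+ content u) • w        ∎)
  where open ≡-Reasoning

0≤⇒sign≡+ : ∀ {i} → 0ℤ ≤ i → sign i ≡ Sign.+
0≤⇒sign≡+ {+ n} _ = refl

≤-of-≡-mod : ∀ b′ m j → m ℕ.< suc b′ → 0ℤ ≤ + m + +[1+ b′ ] * j → + m ≤ + m + +[1+ b′ ] * j
≤-of-≡-mod b′ m (+ n) _ _ rewrite sym (pos-* (suc b′) n) = i≤i+j (+ m) (+ (suc b′ ℕ.* n))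
≤-of-≡-mod b′ m -[1+ n ] m<b 0≤m-bn = ⊥-elim (+≢- (trans (sym (0≤⇒sign≡+ 0≤m-bn)) (sign-⊖-< m<bn)))
  where
  +≢- : Sign.+ ≢ Sign.-
  +≢- ()
  m<bn : m ℕ.< suc b′ ℕ.* suc n
  m<bn = ℕP.<-≤-trans m<b (ℕP.m≤m*n (suc b′) (suc n))

-- Every nondegenerate angle is congruent to one of these (upper-frame below), and here B′ can be computed.
module StandardAngle (x₀ : ℤ) (h G′ : ℕ) where

  H G : ℤ
  H = +[1+ h ]
  G = +[1+ G′ ]

  A C : Point
  A = (x₀ , H)
  C = (G , 0ℤ)

  excess : ℤ → ℤ
  excess x = H * x - x₀

  det-A : ∀ x y → det (A ⊖ origin) ((x , y) ⊖ origin) ≡ x₀ * y - H * x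
  det-A x y = identity x₀ H x y
    where
    identity : ∀ x₀ H x y → (x₀ - 0ℤ) * (y - 0ℤ) - (H - 0ℤ) * (x - 0ℤ) ≡ x₀ * y - H * x
    identity = solve-∀

  det-C : ∀ x y → det (C ⊖ origin) ((x , y) ⊖ origin) ≡ G * y
  det-C x y = identity G x y
    where
    identity : ∀ G x y → (G - 0ℤ) * (y - 0ℤ) - (0ℤ - 0ℤ) * (x - 0ℤ) ≡ G * y
    identity = solve-∀

  lℓ-OC : lℓ origin C ≡ suc G′
  lℓ-OC = trans (cong (λ z → gcd ∣ z ∣ 0) (+-identityʳ G)) (gcd-identityʳ (suc G′))

  height-one : ∀ x y → InAngle A origin C (x , y) → UnitDist origin C (x , y) → y ≡ 1ℤ
  height-one x y inAngle unitDist = *-cancelˡ-≡ G y 1ℤ (begin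
    G * y          ≡⟨ 0≤i⇒+∣i∣≡i nonneg ⟨
    + ∣ G * y ∣    ≡⟨ cong (+_ ∘ ∣_∣) (det-C x y) ⟨
    + ∣ det (C ⊖ origin) ((x , y) ⊖ origin) ∣ ≡⟨ cong +_ (trans unitDist lℓ-OC) ⟩
    G              ≡⟨ *-identityʳ G ⟨
    G * 1ℤ         ∎)
    where
    open ≡-Reasoning
    side : OnSideOf (det (C ⊖ origin) (A ⊖ origin)) (det (C ⊖ origin) ((x , y) ⊖ origin))
    side = InAngle⇒OnSideOf (C ⊖ origin) C origin A (x , y) (det-self (C ⊖ origin))
             (InAngle-swap A origin C (x , y) inAngle)
    nonneg : 0ℤ ≤ G * y
    nonneg = subst (0ℤ ≤_) (det-C x y)
               (OnSideOf-pos⇒nonneg (subst (0ℤ <_) (sym (det-C x₀ H)) (+<+ (s≤s z≤n))) side)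

  excess-nonneg : ∀ x → InAngle A origin C (x , 1ℤ) → 0ℤ ≤ excess x
  excess-nonneg x inAngle = subst (0ℤ ≤_) (trans (cong -_ (det-A x 1ℤ)) (identity x₀ H x))
    (OnSideOf-pos⇒nonneg HG-pos (OnSideOf-neg side))
    where
    identity : ∀ x₀ H x → - (x₀ * 1ℤ - H * x) ≡ H * x - x₀
    identity = solve-∀
    identity′ : ∀ x₀ H G → - (x₀ * 0ℤ - H * G) ≡ H * G
    identity′ = solve-∀
    side : OnSideOf (det (A ⊖ origin) (C ⊖ origin)) (det (A ⊖ origin) ((x , 1ℤ) ⊖ origin))
    side = InAngle⇒OnSideOf (A ⊖ origin) A origin C (x , 1ℤ) (det-self (A ⊖ origin)) inAngle
    HG-pos : 0ℤ < - det (A ⊖ origin) (C ⊖ origin)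
    HG-pos = subst (0ℤ <_) (sym (trans (cong -_ (det-A G 0ℤ)) (identity′ x₀ H G))) (+<+ (s≤s z≤n))

  ldetDist-A : ∀ x → ldetDist origin A (x , 1ℤ) ≡ ∣ excess x ∣
  ldetDist-A x = trans (cong ∣_∣ (trans (det-A x 1ℤ) (identity x₀ H x))) (∣-i∣≡∣i∣ (excess x))
    where
    identity : ∀ x₀ H x → x₀ * 1ℤ - H * x ≡ - (H * x - x₀)
    identity = solve-∀

  -- B′ = (⌈x₀/H⌉, 1), and ⌈x₀/H⌉ = - k where -x₀ = m + k H with 0 ≤ m < H.
  m = (- x₀) %ℕ suc h
  k = (- x₀) /ℕ suc h

  excess-shift : ∀ x → excess x ≡ + m + H * (x - - k)
  excess-shift x = begin
    H * x - x₀                  ≡⟨ cong (λ z → H * x + z) (a≡a%ℕn+[a/ℕn]*n (- x₀) (suc h)) ⟩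
    H * x + (+ m + k * H)       ≡⟨ identity H x (+ m) k ⟩
    + m + H * (x - - k)         ∎
    where
    open ≡-Reasoning
    identity : ∀ H x m k → H * x + (m + k * H) ≡ m + H * (x - - k)
    identity = solve-∀

  excess-k : excess (- k) ≡ + m
  excess-k = trans (excess-shift (- k)) (trans (cong (λ z → + m + H * z) (+-inverseʳ (- k))) (identity (+ m) H))
    where
    identity : ∀ m H → m + H * 0ℤ ≡ m
    identity = solve-∀

  inAngle : InAngle A origin C (- k , 1ℤ)
  inAngle = suc G′ , m , G′ ℕ.+ h ℕ.* suc G′ , cong₂ _,_ first (second H G (+ m))
    where
    open ≡-Reasoning
    H-k≡x₀+m : H * - k ≡ x₀ + + m
    H-k≡x₀+m = trans (identity H (- k) x₀) (cong (λ z → x₀ + z) excess-k)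
      where
      identity : ∀ H t x₀ → H * t ≡ x₀ + (H * t - x₀)
      identity = solve-∀
    first : H * G * (- k - 0ℤ) ≡ G * (x₀ - 0ℤ) + + m * (G - 0ℤ)
    first = begin
      H * G * (- k - 0ℤ)              ≡⟨ identity₁ H G (- k) ⟩
      G * (H * - k)                   ≡⟨ cong (G *_) H-k≡x₀+m ⟩
      G * (x₀ + + m)                  ≡⟨ identity₂ G x₀ (+ m) ⟩
      G * (x₀ - 0ℤ) + + m * (G - 0ℤ)  ∎
      where
      identity₁ : ∀ H G t → H * G * (t - 0ℤ) ≡ G * (H * t)
      identity₁ = solve-∀
      identity₂ : ∀ G x₀ m → G * (x₀ + m) ≡ G * (x₀ - 0ℤ) + m * (G - 0ℤ)
      identity₂ = solve-∀
    second : ∀ H G m → H * G * (1ℤ - 0ℤ) ≡ G * (H - 0ℤ) + m * (0ℤ - 0ℤ)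
    second = solve-∀

  unitDist : UnitDist origin C (- k , 1ℤ)
  unitDist = trans (cong ∣_∣ (det-C (- k) 1ℤ)) (trans (cong ∣_∣ (*-identityʳ G)) (sym lℓ-OC))

  closest : ∀ Q → InAngle A origin C Q → UnitDist origin C Q → ldetDist origin A (- k , 1ℤ) ℕ.≤ ldetDist origin A Q
  closest (x , y) inAngleQ unitDistQ with height-one x y inAngleQ unitDistQ
  ... | refl = begin
    ldetDist origin A (- k , 1ℤ)  ≡⟨ trans (ldetDist-A (- k)) (cong ∣_∣ excess-k) ⟩
    m                             ≤⟨ drop‿+≤+ m≤excess ⟩
    ∣ excess x ∣                  ≡⟨ ldetDist-A x ⟨
    ldetDist origin A (x , 1ℤ)    ∎
    where
    open ℕP.≤-Reasoning
    nonneg = excess-nonneg x inAngleQ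
    m≤excess : + m ≤ + ∣ excess x ∣
    m≤excess = subst (+ m ≤_) (trans (sym (excess-shift x)) (sym (0≤i⇒+∣i∣≡i nonneg)))
      (≤-of-≡-mod h m (x - - k) (n%ℕd<d (- x₀) (suc h)) (subst (0ℤ ≤_) (excess-shift x) nonneg))

  B′ : IsB′ A origin C (- k , 1ℤ)
  B′ = inAngle , unitDist , closest

det-apply-≢0 : ∀ g A B C → det (A ⊖ B) (C ⊖ B) ≢ 0ℤ → det (apply g A ⊖ apply g B) (apply g C ⊖ apply g B) ≢ 0ℤ
det-apply-≢0 g A B C nondeg eq with unimodular g
... | inj₁ δ≡1 = nondeg (trans (sym (*-identityˡ _)) (trans (cong (_* det (A ⊖ B) (C ⊖ B)) (sym δ≡1))
                   (trans (sym (det-apply g A B C)) eq)))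
... | inj₂ δ≡-1 = nondeg (neg-injective (trans (sym (-1*i≡-i _)) (trans (cong (_* det (A ⊖ B) (C ⊖ B)) (sym δ≡-1))
                   (trans (sym (det-apply g A B C)) eq))))

nondegenerate⇒content≢0 : ∀ A B C → det (A ⊖ B) (C ⊖ B) ≢ 0ℤ → content (C ⊖ B) ≢ 0
nondegenerate⇒content≢0 A B C nondeg content≡0 =
  nondeg (trans (cong (det (A ⊖ B)) (content≡0⇒origin (C ⊖ B) content≡0)) (det-originʳ (A ⊖ B)))

reflection : Aff
reflection = record { a = 1ℤ ; b = 0ℤ ; c = 0ℤ ; d = - 1ℤ ; e = 0ℤ ; f = 0ℤ ; unimodular = inj₂ refl }

apply-reflection : ∀ x y → apply reflection (x , y) ≡ (x , - y)
apply-reflection x y = cong₂ _,_ (first x y) (second x y)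
  where
  first : ∀ x y → 1ℤ * x + 0ℤ * y + 0ℤ ≡ x
  first = solve-∀
  second : ∀ x y → 0ℤ * x + - 1ℤ * y + 0ℤ ≡ - y
  second = solve-∀

upper-frame : ∀ A B C G′ → content (C ⊖ B) ≡ suc G′ → det (A ⊖ B) (C ⊖ B) ≢ 0ℤ →
  Σ Aff λ g → apply g B ≡ origin × apply g C ≡ (+[1+ G′ ] , 0ℤ) ×
              Σ ℤ λ x₀ → Σ ℕ λ h → apply g A ≡ (x₀ , +[1+ h ])
upper-frame A B C G′ eq nondeg = normalise-height (proj₂ (apply g A)) refl
  where
  g = proj₁ (primitive-frame B C G′ eq)
  gB≡origin = proj₁ (proj₂ (primitive-frame B C G′ eq))
  gC≡G = proj₂ (proj₂ (primitive-frame B C G′ eq))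
  x₀ = proj₁ (apply g A)
  det-standard : ∀ y → det ((x₀ , y) ⊖ origin) ((+[1+ G′ ] , 0ℤ) ⊖ origin) ≡ - (y * +[1+ G′ ])
  det-standard y = identity x₀ y +[1+ G′ ]
    where
    identity : ∀ x y G → (x - 0ℤ) * (0ℤ - 0ℤ) - (y - 0ℤ) * (G - 0ℤ) ≡ - (y * G)
    identity = solve-∀
  normalise-height : ∀ y → apply g A ≡ (x₀ , y) →
    Σ Aff λ g → apply g B ≡ origin × apply g C ≡ (+[1+ G′ ] , 0ℤ) ×
                Σ ℤ λ x₀ → Σ ℕ λ h → apply g A ≡ (x₀ , +[1+ h ])
  normalise-height +0 gA≡ = ⊥-elim (det-apply-≢0 g A B C nondeg
    (subst₂ (λ P Q → det (P ⊖ Q) (apply g C ⊖ Q) ≡ 0ℤ) (sym gA≡) (sym gB≡origin)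
      (trans (cong (λ R → det ((x₀ , 0ℤ) ⊖ origin) (R ⊖ origin)) gC≡G) (det-standard 0ℤ))))
  normalise-height +[1+ h ] gA≡ = g , gB≡origin , gC≡G , x₀ , h , gA≡
  normalise-height -[1+ h ] gA≡ = reflection ∘ᵃ g ,
    reflect gB≡origin , reflect gC≡G , x₀ , h , reflect gA≡
    where
    reflect : ∀ {P x y} → apply g P ≡ (x , y) → apply (reflection ∘ᵃ g) P ≡ (x , - y)
    reflect {P} {x} {y} gP≡ = trans (apply-∘ᵃ reflection g P) (trans (cong (apply reflection) gP≡) (apply-reflection x y))

B′-exists : ∀ A B C → det (A ⊖ B) (C ⊖ B) ≢ 0ℤ → Σ Point (IsB′ A B C)
B′-exists A B C nondeg = from-content (content (C ⊖ B)) refl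
  where
  from-content : ∀ n → content (C ⊖ B) ≡ n → Σ Point (IsB′ A B C)
  from-content zero eq = ⊥-elim (nondegenerate⇒content≢0 A B C nondeg eq)
  from-content (suc G′) eq = apply (g ⁻¹) P₀ ,
    subst₄ IsB′ {P = apply (g ⁻¹) P₀} (back {A} gA≡) (back {B} gB≡origin) (back {C} gC≡G) refl standard
    where
    frame-ABC = upper-frame A B C G′ eq nondeg
    g = proj₁ frame-ABC
    gB≡origin = proj₁ (proj₂ frame-ABC)
    gC≡G = proj₁ (proj₂ (proj₂ frame-ABC))
    x₀ = proj₁ (proj₂ (proj₂ (proj₂ frame-ABC)))
    h = proj₁ (proj₂ (proj₂ (proj₂ (proj₂ frame-ABC))))
    gA≡ = proj₂ (proj₂ (proj₂ (proj₂ (proj₂ frame-ABC))))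
    P₀ = (- StandardAngle.k x₀ h G′ , 1ℤ)
    back : ∀ {P Q} → apply g P ≡ Q → apply (g ⁻¹) Q ≡ P
    back {P} refl = ⁻¹-inverseˡ g P
    standard : IsB′ (apply (g ⁻¹) (x₀ , +[1+ h ])) (apply (g ⁻¹) origin)
                    (apply (g ⁻¹) (+[1+ G′ ] , 0ℤ)) (apply (g ⁻¹) P₀)
    standard = IsB′-apply (g ⁻¹) (StandardAngle.B′ x₀ h G′)

C′-exists : ∀ B C D → det (D ⊖ C) (B ⊖ C) ≢ 0ℤ → Σ Point (IsC′ B C D)
C′-exists B C D nondeg = proj₁ B′ , IsB′⇒IsC′ B C D (proj₁ B′) (proj₂ B′)
  where B′ = B′-exists D C B nondeg

ChordCurv-exists : ∀ A B C D → SameOrientation A B C D → Σ ℤ (ChordCurv A B C D)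
ChordCurv-exists A B C D same =
  + lℓ B C - signedLength (C ⊖ B) (proj₁ C′ ⊖ proj₁ B′) - + 2 ,
  proj₁ B′ , proj₁ C′ , proj₂ B′ , proj₂ C′ , refl
  where
  B′ = B′-exists A B C (proj₁ (SameSign⇒≢0 same))
  C′ = C′-exists B C D (λ eq → proj₂ (SameSign⇒≢0 same) (trans (det-antisym (B ⊖ C) (D ⊖ C)) (cong -_ eq)))

chord-signedLength-apply : ∀ g A B C D P Q → SameOrientation A B C D → IsB′ A B C P → IsC′ B C D Q →
  signedLength (apply g C ⊖ apply g B) (apply g Q ⊖ apply g P) ≡ signedLength (C ⊖ B) (Q ⊖ P)
chord-signedLength-apply g A B C D P Q same isB′ isC′ =
  trans (cong₂ signedLength (apply-⊖ g C B) (apply-⊖ g Q P))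
    (signedLength-linear g (C ⊖ B) (Q ⊖ P) (nondegenerate⇒content≢0 A B C (proj₁ (SameSign⇒≢0 same)))
      (B′C′∥BC A B C D P Q same isB′ isC′))

ChordCurv-apply : ∀ g A B C D κ → SameOrientation A B C D → ChordCurv A B C D κ →
  ChordCurv (apply g A) (apply g B) (apply g C) (apply g D) κ
ChordCurv-apply g A B C D κ same (P , Q , isB′ , isC′ , κ≡) =
  apply g P , apply g Q , IsB′-apply g isB′ , IsC′-apply g isC′ ,
  trans κ≡ (cong₂ (λ l s → + l - s - + 2) (sym (lℓ-apply g B C))
                 (sym (chord-signedLength-apply g A B C D P Q same isB′ isC′)))

-- Reconstructing the congruence

apply-determined : ∀ g h X Y C → apply g X ≡ apply h X → apply g Y ≡ apply h Y → apply g C ≡ apply h C →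
  det (Y ⊖ X) (C ⊖ X) ≢ 0ℤ → ∀ Z → apply g Z ≡ apply h Z
apply-determined g h X Y C gX≡hX gY≡hY gC≡hC nondeg Z = begin
  apply g Z                          ≡⟨ apply-via g Z X ⟩
  apply g X ⊕ linear g (Z ⊖ X)       ≡⟨ cong₂ _⊕_ gX≡hX (linear≡ (Z ⊖ X)) ⟩
  apply h X ⊕ linear h (Z ⊖ X)       ≡⟨ apply-via h Z X ⟨
  apply h Z                          ∎
  where
  open ≡-Reasoning
  u = Y ⊖ X
  v = C ⊖ X
  on-edge : ∀ {P} → apply g P ≡ apply h P → linear g (P ⊖ X) ≡ linear h (P ⊖ X)
  on-edge {P} gP≡hP = trans (sym (apply-⊖ g P X)) (trans (cong₂ _⊖_ gP≡hP gX≡hX) (apply-⊖ h P X))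
  linear≡ : ∀ w → linear g w ≡ linear h w
  linear≡ w = •-cancelˡ (det u v) (linear g w) (linear h w) nondeg (begin
    det u v • linear g w                                  ≡⟨ linear-• g (det u v) w ⟨
    linear g (det u v • w)                                ≡⟨ cong (linear g) (cramer u v w) ⟩
    linear g (((- det v w) • u) ⊕ (det u w • v))          ≡⟨ linear-comb g (- det v w) u (det u w) v ⟩
    ((- det v w) • linear g u) ⊕ (det u w • linear g v)   ≡⟨ cong₂ (λ p q → ((- det v w) • p) ⊕ (det u w • q))
                                                                 (on-edge gY≡hY) (on-edge gC≡hC) ⟩
    ((- det v w) • linear h u) ⊕ (det u w • linear h v)   ≡⟨ linear-comb h (- det v w) u (det u w) v ⟨
    linear h (((- det v w) • u) ⊕ (det u w • v))          ≡⟨ cong (linear h) (cramer u v w) ⟨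
    linear h (det u v • w)                                ≡⟨ linear-• h (det u v) w ⟩
    det u v • linear h w                                  ∎)

ray-endpoint : ∀ h B A B′ A′ → apply h B ≡ B′ → SameRay (apply h A ⊖ apply h B) (A′ ⊖ B′) →
  lℓ B A ≡ lℓ B′ A′ → apply h A ≡ A′
ray-endpoint h B A _ A′ refl ray same-length = ⊖-cancelʳ (apply h A) A′ (apply h B)
  (sameRay-content-injective (apply h A ⊖ apply h B) (A′ ⊖ apply h B) ray (trans (lℓ-apply h B A) same-length))

angle-sides-congruent : ∀ A B C A′ B′ C′ → AngleCong A B C A′ B′ C′ →
  lℓ A B ≡ lℓ A′ B′ → lℓ B C ≡ lℓ B′ C′ →
  Σ Aff λ h → apply h A ≡ A′ × apply h B ≡ B′ × apply h C ≡ C′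
angle-sides-congruent A B C A′ B′ C′ (h , hB≡B′ , rayA , rayC) lAB lBC =
  h , ray-endpoint h B A B′ A′ hB≡B′ rayA (trans (lℓ-sym B A) (trans lAB (lℓ-sym A′ B′))) ,
  hB≡B′ , ray-endpoint h B C B′ C′ hB≡B′ rayC lBC

next-vertex : ∀ g W X Y Z W′ X′ Y′ Z′ κ → apply g W ≡ W′ → apply g X ≡ X′ → apply g Y ≡ Y′ →
  AngleCong X Y Z X′ Y′ Z′ → lℓ Y Z ≡ lℓ Y′ Z′ → ChordCurv W X Y Z κ → ChordCurv W′ X′ Y′ Z′ κ →
  SameOrientation W X Y Z → SameOrientation W′ X′ Y′ Z′ → apply g Z ≡ Z′
next-vertex g W X Y Z _ _ _ Z′ κ refl refl refl (h , hY≡gY , rayX , rayZ) lYZ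
  (P , Q , isB′ , isC′@(_ , unitDistQ , _) , κ≡) (P′ , Q′ , isB′′ , isC′′ , κ≡′) same same′ =
  trans (apply-determined g h X Y Q (sym hX≡gX) (sym hY≡gY) (trans gQ≡Q′ (sym hQ≡Q′)) nondeg-XYQ Z) hZ≡Z′
  where
  gW = apply g W
  gX = apply g X
  gY = apply g Y
  XY = gY ⊖ gX
  nondeg′ = SameSign⇒≢0 same′
  hX≡gX : apply h X ≡ gX
  hX≡gX = ray-endpoint h Y X gY gX hY≡gY rayX (sym (lℓ-apply g Y X))
  hZ≡Z′ : apply h Z ≡ Z′
  hZ≡Z′ = ray-endpoint h Y Z gY Z′ hY≡gY rayZ lYZ
  hQ≡Q′ : apply h Q ≡ Q′
  hQ≡Q′ = C′-unique gX gY Z′ (apply h Q) Q′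
    (λ eq → proj₂ nondeg′ (trans (det-antisym (gX ⊖ gY) (Z′ ⊖ gY)) (cong -_ eq)))
    (subst₄ IsC′ {P = apply h Q} hX≡gX hY≡gY hZ≡Z′ refl (IsC′-apply h isC′)) isC′′
  gP≡P′ : apply g P ≡ P′
  gP≡P′ = B′-unique gW gX gY (apply g P) P′ (proj₁ nondeg′) (IsB′-apply g isB′) isB′′
  gQ⊖gP∥XY : det XY (apply g Q ⊖ P′) ≡ 0ℤ
  gQ⊖gP∥XY = subst (λ R → det XY (apply g Q ⊖ R) ≡ 0ℤ) gP≡P′
    (B′C′∥BC gW gX gY (apply g Z) (apply g P) (apply g Q) (SameOrientation-apply g same)
      (IsB′-apply g isB′) (IsC′-apply g isC′))
  same-signedLength : signedLength XY (apply g Q ⊖ P′) ≡ signedLength XY (Q′ ⊖ P′)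
  same-signedLength = begin
    signedLength XY (apply g Q ⊖ P′)                        ≡⟨ cong (λ R → signedLength XY (apply g Q ⊖ R)) gP≡P′ ⟨
    signedLength XY (apply g Q ⊖ apply g P)                 ≡⟨ chord-signedLength-apply g W X Y Z P Q same isB′ isC′ ⟩
    signedLength (Y ⊖ X) (Q ⊖ P)                            ≡⟨ identity (+ lℓ X Y) _ ⟩
    + lℓ X Y - (+ lℓ X Y - signedLength (Y ⊖ X) (Q ⊖ P) - + 2) - + 2
                          ≡⟨ cong₂ (λ l k → + l - k - + 2) (sym (lℓ-apply g X Y)) (trans (sym κ≡) κ≡′) ⟩
    + lℓ gX gY - (+ lℓ gX gY - signedLength XY (Q′ ⊖ P′) - + 2) - + 2
                          ≡⟨ identity (+ lℓ gX gY) _ ⟨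
    signedLength XY (Q′ ⊖ P′)                               ∎
    where
    open ≡-Reasoning
    identity : ∀ l s → s ≡ l - (l - s - + 2) - + 2
    identity = solve-∀
  gQ≡Q′ : apply g Q ≡ Q′
  gQ≡Q′ = ⊖-cancelʳ (apply g Q) Q′ P′ (signedLength-injective XY (apply g Q ⊖ P′) (Q′ ⊖ P′)
    (nondegenerate⇒content≢0 gW gX gY (proj₁ nondeg′)) gQ⊖gP∥XY
    (B′C′∥BC gW gX gY Z′ P′ Q′ same′ isB′′ isC′′)
    same-signedLength)
  nondeg-XYQ : det (Y ⊖ X) (Q ⊖ X) ≢ 0ℤ
  nondeg-XYQ eq = nondegenerate⇒content≢0 W X Y (proj₁ (SameSign⇒≢0 same))
    (trans (sym unitDistQ) (cong ∣_∣ eq))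

segment-congruent : ∀ P Q P′ Q′ → lℓ P Q ≡ lℓ P′ Q′ → Σ Aff λ g → apply g P ≡ P′ × apply g Q ≡ Q′
segment-congruent P Q P′ Q′ same-length = (g′ ⁻¹) ∘ᵃ g , via-frames P P′ gP≡origin g′P′≡origin ,
  via-frames Q Q′ (trans gQ≡l (cong (λ l → (+ l , 0ℤ)) same-length)) g′Q′≡l
  where
  g = proj₁ (frame P Q)
  gP≡origin = proj₁ (proj₂ (frame P Q))
  gQ≡l = proj₂ (proj₂ (frame P Q))
  g′ = proj₁ (frame P′ Q′)
  g′P′≡origin = proj₁ (proj₂ (frame P′ Q′))
  g′Q′≡l = proj₂ (proj₂ (frame P′ Q′))
  via-frames : ∀ R R′ {S} → apply g R ≡ S → apply g′ R′ ≡ S → apply ((g′ ⁻¹) ∘ᵃ g) R ≡ R′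
  via-frames R R′ gR≡S g′R′≡S = begin
    apply ((g′ ⁻¹) ∘ᵃ g) R      ≡⟨ apply-∘ᵃ (g′ ⁻¹) g R ⟩
    apply (g′ ⁻¹) (apply g R)   ≡⟨ cong (apply (g′ ⁻¹)) (trans gR≡S (sym g′R′≡S)) ⟩
    apply (g′ ⁻¹) (apply g′ R′) ≡⟨ ⁻¹-inverseˡ g′ R′ ⟩
    R′                          ∎
    where open ≡-Reasoning

Agree : Aff → (ℕ → Point) → (ℕ → Point) → ℕ → Set
Agree g A B j = ∀ i → i ℕ.≤ j → apply g (A i) ≡ B i

Agree-extend : ∀ g A B j → Agree g A B j → apply g (A (suc j)) ≡ B (suc j) → Agree g A B (suc j)
Agree-extend g A B j agree next i i≤1+j with ℕP.m≤n⇒m<n∨m≡n i≤1+j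
... | inj₁ i<1+j = agree i (ℕ.s≤s⁻¹ i<1+j)
... | inj₂ refl = next

Agree-base : ∀ A B → AngleCong (A 0) (A 1) (A 2) (B 0) (B 1) (B 2) →
  lℓ (A 0) (A 1) ≡ lℓ (B 0) (B 1) → lℓ (A 1) (A 2) ≡ lℓ (B 1) (B 2) → Σ Aff λ h → Agree h A B 2
Agree-base A B angle l₀₁ l₁₂ with angle-sides-congruent (A 0) (A 1) (A 2) (B 0) (B 1) (B 2) angle l₀₁ l₁₂
... | h , h₀ , h₁ , h₂ = h , agree
  where
  agree : Agree h A B 2
  agree 0 _ = h₀
  agree 1 _ = h₁
  agree 2 _ = h₂
  agree (suc (suc (suc i))) (s≤s (s≤s ()))

Agree-step : ∀ g A B k κ → Agree g A B (2 ℕ.+ k) →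
  AngleCong (A (1 ℕ.+ k)) (A (2 ℕ.+ k)) (A (3 ℕ.+ k)) (B (1 ℕ.+ k)) (B (2 ℕ.+ k)) (B (3 ℕ.+ k)) →
  lℓ (A (2 ℕ.+ k)) (A (3 ℕ.+ k)) ≡ lℓ (B (2 ℕ.+ k)) (B (3 ℕ.+ k)) →
  ChordCurv (A k) (A (1 ℕ.+ k)) (A (2 ℕ.+ k)) (A (3 ℕ.+ k)) κ →
  ChordCurv (B k) (B (1 ℕ.+ k)) (B (2 ℕ.+ k)) (B (3 ℕ.+ k)) κ →
  SameOrientation (A k) (A (1 ℕ.+ k)) (A (2 ℕ.+ k)) (A (3 ℕ.+ k)) →
  SameOrientation (B k) (B (1 ℕ.+ k)) (B (2 ℕ.+ k)) (B (3 ℕ.+ k)) →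
  Agree g A B (3 ℕ.+ k)
Agree-step g A B k κ agree angle length curvA curvB sameA sameB = Agree-extend g A B (2 ℕ.+ k) agree
  (next-vertex g (A k) (A (1 ℕ.+ k)) (A (2 ℕ.+ k)) (A (3 ℕ.+ k)) (B k) (B (1 ℕ.+ k)) (B (2 ℕ.+ k)) (B (3 ℕ.+ k)) κ
    (agree k (ℕP.m≤n+m k 2)) (agree (1 ℕ.+ k) (ℕP.n≤1+n _)) (agree (2 ℕ.+ k) ℕP.≤-refl)
    angle length curvA curvB sameA sameB)

AngleCong-of-apply : ∀ g {A B C A′ B′ C′} → apply g A ≡ A′ → apply g B ≡ B′ → apply g C ≡ C′ →
  AngleCong A B C A′ B′ C′
AngleCong-of-apply g refl refl refl = g , refl , (0 , 0 , refl) , (0 , 0 , refl)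

lℓ-of-apply : ∀ g {A B A′ B′} → apply g A ≡ A′ → apply g B ≡ B′ → lℓ A B ≡ lℓ A′ B′
lℓ-of-apply g {A} {B} refl refl = sym (lℓ-apply g A B)

ChordCurv-of-apply : ∀ g {A B C D A′ B′ C′ D′} → apply g A ≡ A′ → apply g B ≡ B′ → apply g C ≡ C′ → apply g D ≡ D′ →
  SameOrientation A B C D → Σ ℤ λ κ → ChordCurv A B C D κ × ChordCurv A′ B′ C′ D′ κ
ChordCurv-of-apply g {A} {B} {C} {D} refl refl refl refl same =
  κ , curvature , ChordCurv-apply g A B C D κ same curvature
  where
  κ = proj₁ (ChordCurv-exists A B C D same)
  curvature = proj₂ (ChordCurv-exists A B C D same)

LocallyConvex⇒SameOrientation : ∀ n A i → LocallyConvex n A → 2 ℕ.+ i ℕ.≤ n →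
  SameOrientation (A i) (A (1 ℕ.+ i)) (A (2 ℕ.+ i)) (A (3 ℕ.+ i))
LocallyConvex⇒SameOrientation n A i (inj₁ pos) 2+i≤n = inj₁ (pos i (ℕP.<⇒≤ 2+i≤n) , pos (suc i) 2+i≤n)
LocallyConvex⇒SameOrientation n A i (inj₂ neg) 2+i≤n = inj₂ (neg i (ℕP.<⇒≤ 2+i≤n) , neg (suc i) 2+i≤n)

-- Anticlockwise order makes every angle ∠Aᵢ₋₁AᵢAᵢ₊₁ negatively oriented.
ConvexPolygon⇒NegAngle : ∀ n A → ConvexPolygon n A → ∀ i → NegAngle (A i) (A (1 ℕ.+ i)) (A (2 ℕ.+ i))
ConvexPolygon⇒NegAngle n A (3≤n , _ , left) i =
  subst (_< 0ℤ) (sym (flip (A i) (A (1 ℕ.+ i)) (A (2 ℕ.+ i))))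
    (neg-mono-< (subst (λ j → 0ℤ < det (A (1 ℕ.+ i) ⊖ A i) (A j ⊖ A i)) (ℕP.+-comm i 2) (left i 2 (s≤s (s≤s z≤n)) 3≤n)))
  where
  flip : ∀ P Q R → det (P ⊖ Q) (R ⊖ Q) ≡ - det (Q ⊖ P) (R ⊖ P)
  flip (p , p′) (q , q′) (r , r′) = identity p p′ q q′ r r′
    where
    identity : ∀ p p′ q q′ r r′ →
      (p - q) * (r′ - q′) - (p′ - q′) * (r - q) ≡ - ((q - p) * (r′ - p′) - (q′ - p′) * (r - p))
    identity = solve-∀

ConvexPolygon⇒SameOrientation : ∀ n A → ConvexPolygon n A → ∀ i →
  SameOrientation (A i) (A (1 ℕ.+ i)) (A (2 ℕ.+ i)) (A (3 ℕ.+ i))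
ConvexPolygon⇒SameOrientation n A convex i =
  inj₂ (ConvexPolygon⇒NegAngle n A convex i , ConvexPolygon⇒NegAngle n A convex (suc i))

broken-invariants : ∀ n A B → LocallyConvex n A → BrokenCong n A B → BrokenSameAC n A B × BrokenSameLengths n A B
broken-invariants n A B convex (g , agree) = (angles , curvatures) , lengths
  where
  angles : ∀ i → i ℕ.< n → AngleCong (A i) (A (1 ℕ.+ i)) (A (2 ℕ.+ i)) (B i) (B (1 ℕ.+ i)) (B (2 ℕ.+ i))
  angles i i<n = AngleCong-of-apply g (agree i (ℕP.≤-trans (ℕP.m≤n+m i 2) (s≤s i<n)))
    (agree (1 ℕ.+ i) (ℕP.<⇒≤ (s≤s i<n))) (agree (2 ℕ.+ i) (s≤s i<n))
  curvatures : ∀ i → 2 ℕ.+ i ℕ.≤ n → Σ ℤ λ κ →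
    ChordCurv (A i) (A (1 ℕ.+ i)) (A (2 ℕ.+ i)) (A (3 ℕ.+ i)) κ × ChordCurv (B i) (B (1 ℕ.+ i)) (B (2 ℕ.+ i)) (B (3 ℕ.+ i)) κ
  curvatures i 2+i≤n = ChordCurv-of-apply g
    (agree i (ℕP.≤-trans (ℕP.m≤n+m i 3) (s≤s 2+i≤n))) (agree (1 ℕ.+ i) (ℕP.≤-trans (ℕP.m≤n+m (1 ℕ.+ i) 2) (s≤s 2+i≤n)))
    (agree (2 ℕ.+ i) (ℕP.<⇒≤ (s≤s 2+i≤n))) (agree (3 ℕ.+ i) (s≤s 2+i≤n))
    (LocallyConvex⇒SameOrientation n A i convex 2+i≤n)
  lengths : ∀ i → i ℕ.≤ n → lℓ (A i) (A (1 ℕ.+ i)) ≡ lℓ (B i) (B (1 ℕ.+ i))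
  lengths i i≤n = lℓ-of-apply g (agree i (ℕP.<⇒≤ (s≤s i≤n))) (agree (1 ℕ.+ i) (s≤s i≤n))

broken-congruent : ∀ n A B → LocallyConvex n A → LocallyConvex n B →
  BrokenSameAC n A B → BrokenSameLengths n A B → BrokenCong n A B
broken-congruent zero A B _ _ _ lengths = g , agree
  where
  segment = segment-congruent (A 0) (A 1) (B 0) (B 1) (lengths 0 z≤n)
  g = proj₁ segment
  agree : Agree g A B 1
  agree 0 _ = proj₁ (proj₂ segment)
  agree 1 _ = proj₂ (proj₂ segment)
  agree (suc (suc i)) (s≤s ())
broken-congruent (suc n) A B convexA convexB (angles , curvatures) lengths = h , extend n ℕP.≤-refl
  where
  base = Agree-base A B (angles 0 (s≤s z≤n)) (lengths 0 z≤n) (lengths 1 (s≤s z≤n))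
  h = proj₁ base
  extend : ∀ k → k ℕ.≤ n → Agree h A B (2 ℕ.+ k)
  extend zero _ = proj₂ base
  extend (suc k) k<n = Agree-step h A B k (proj₁ (curvatures k (s≤s k<n))) (extend k (ℕP.<⇒≤ k<n))
    (angles (1 ℕ.+ k) (s≤s k<n)) (lengths (2 ℕ.+ k) (s≤s k<n))
    (proj₁ (proj₂ (curvatures k (s≤s k<n)))) (proj₂ (proj₂ (curvatures k (s≤s k<n))))
    (LocallyConvex⇒SameOrientation (suc n) A k convexA (s≤s k<n))
    (LocallyConvex⇒SameOrientation (suc n) B k convexB (s≤s k<n))

polygon-invariants : ∀ n A B → ConvexPolygon n A → PolyCong n A B → PolySameAC n A B × PolySameLengths n A B
polygon-invariants n A B convex (g , agree) =
  ( (λ i → AngleCong-of-apply g (agree i) (agree (1 ℕ.+ i)) (agree (2 ℕ.+ i)))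
  , (λ i → ChordCurv-of-apply g (agree i) (agree (1 ℕ.+ i)) (agree (2 ℕ.+ i)) (agree (3 ℕ.+ i))
             (ConvexPolygon⇒SameOrientation n A convex i)) )
  , (λ i → lℓ-of-apply g (agree i) (agree (1 ℕ.+ i)))

polygon-congruent : ∀ n A B → ConvexPolygon n A → ConvexPolygon n B →
  PolySameAC n A B → PolySameLengths n A B → PolyCong n A B
polygon-congruent n A B convexA convexB (angles , curvatures) lengths =
  h , λ i → extend i i (ℕP.≤-trans (ℕP.n≤1+n i) (ℕP.n≤1+n (suc i)))
  where
  base = Agree-base A B (angles 0) (lengths 0) (lengths 1)
  h = proj₁ base
  extend : ∀ k → Agree h A B (2 ℕ.+ k)
  extend zero = proj₂ base
  extend (suc k) = Agree-step h A B k (proj₁ (curvatures k)) (extend k) (angles (1 ℕ.+ k)) (lengths (2 ℕ.+ k))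
    (proj₁ (proj₂ (curvatures k))) (proj₂ (proj₂ (curvatures k)))
    (ConvexPolygon⇒SameOrientation n A convexA k) (ConvexPolygon⇒SameOrientation n B convexB k)

mainTheorem1 :
    (∀ (n : ℕ) (A B : ℕ → Point) → LocallyConvex n A → LocallyConvex n B →
      (BrokenCong n A B ⇔ (BrokenSameAC n A B × BrokenSameLengths n A B)))
    × (∀ (n : ℕ) (A B : ℕ → Point) → ConvexPolygon n A → ConvexPolygon n B →
      (PolyCong n A B ⇔ (PolySameAC n A B × PolySameLengths n A B)))
mainTheorem1 =
  (λ n A B convexA convexB → mk⇔ (broken-invariants n A B convexA)
                                  (λ (same-ac , same-lengths) → broken-congruent n A B convexA convexB same-ac same-lengths)) ,
  (λ n A B convexA convexB → mk⇔ (polygon-invariants n A B convexA)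
                                  (λ (same-ac , same-lengths) → polygon-congruent n A B convexA convexB same-ac same-lengths))
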